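{- Let $\Gamma$ be a tetravalent $G$-half-arc-transitive graph for some $G\le\mathrm{Aut}(\Gamma)$ and let $r=\mathrm{rad}_G(\Gamma)$, $a=\mathrm{att}_G(\Gamma)$ and $q=\mathrm{jum}_G(\Gamma)$. If $a$ does not divide $r$ and $a\neq|V(\Gamma)|$, then $q^2\equiv\pm1\pmod{a}$, and $Q_G(\Gamma)=\{q\}$.
   Context: All graphs are finite, simple, connected and undirected. For $G\le\mathrm{Aut}(\Gamma)$, $\Gamma$ is $G$-half-arc-transitive if $G$ is transitive on vertices and edges but not on arcs. For tetravalent such $\Gamma$, $G$ has two paired arc-orbits, each containing exactly one arc of each edge; choosing one gives a $G$-induced orientation (tail/head). A $G$-alternating cycle is a cycle whose consecutive edges have opposite orientations; all have length $2r$, $r=\mathrm{rad}_G(\Gamma)$. Each vertex lies on exactly two of them; two distinct non-disjoint ones meet in exactly $a=\mathrm{att}_G(\Gamma)$ vertices; $a\mid 2r$, and with $\ell=2r/a$, if $C=(u_0,\ldots,u_{2r-1})$, $C'=(v_0,\ldots,v_{2r-1})$ are the two $G$-alternating cycles through $v=u_0=v_0$ (indices mod $2r$), then $V(C)\cap V(C')=\{u_{i\ell}\}_{0\le i<a}=\{v_{i\ell}\}_{0\le i<a}$. Fixing an orientation and taking $v$ the tail of both arcs of $C$ at $v$, define $q_t=\min\{q\ge0:v_{q\ell}\in\{u_\ell,u_{ -\ell}\}\}$ and $q_h=\min\{q\ge0:u_{q\ell}\in\{v_\ell,v_{ -\ell}\}\}$ (both $0$ if $a=1$); they are independent of $v$.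 $Q_G(\Gamma)=\{q_t,q_h\}$ and $\mathrm{jum}_G(\Gamma)=\min Q_G(\Gamma)$. -}

module Defs where

open import Data.Nat using (ℕ; zero; suc; _+_; _*_; _∸_; _≤_; _<_)
open import Data.Bool using (Bool; true; false)
open import Data.Fin using (Fin)
open import Data.Fin.Properties using (_≟_)
open import Data.List using (List; length; filter; upTo)
open import Data.List.Relation.Unary.Any using (any?)
open import Data.Product using (Σ; ∃; _×_; _,_)
open import Data.Sum using (_⊎_)
open import Data.Empty using (⊥)
open import Relation.Nullary using (¬_)
open import Relation.Binary.PropositionalEquality using (_≡_)
import Data.Integer as ℤ
import Data.Integer.Divisibility as ℤDiv

record Graph (n : ℕ) : Set where
  field
    Adj     : Fin n → Fin n → Bool
    adj-sym : ∀ u v → Adj u v ≡ Adj v u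
    irrefl  : ∀ u → Adj u u ≡ false

module _ {n : ℕ} (Γ : Graph n) where
  open Graph Γ

  Edge : Fin n → Fin n → Set
  Edge u v = Adj u v ≡ true

  data Reach : Fin n → Fin n → Set where
    here : ∀ {u} → Reach u u
    step : ∀ {u v w} → Edge u v → Reach v w → Reach u w

  Connected : Set
  Connected = ∀ u v → Reach u v

  Tetravalent : Set
  Tetravalent = ∀ v → Σ (Fin 4 → Fin n) λ nb →
      (∀ i j → nb i ≡ nb j → i ≡ j)
    × (∀ i → Edge v (nb i))
    × (∀ w → Edge v w → ∃ λ i → nb i ≡ w)

  IsAut : (Fin n → Fin n) → Set
  IsAut g = (Σ (Fin n → Fin n) λ h → (∀ x → h (g x) ≡ x) × (∀ x → g (h x) ≡ x))
          × (∀ u v → Adj (g u) (g v) ≡ Adj u v)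

  record Subgroup : Set₁ where
    field
      Mem    : (Fin n → Fin n) → Set
      aut    : ∀ g → Mem g → IsAut g
      has-id : Mem (λ x → x)
      comp   : ∀ g h → Mem g → Mem h → Mem (λ x → g (h x))
      inv    : ∀ g → Mem g → Σ (Fin n → Fin n) λ h →
                 Mem h × (∀ x → h (g x) ≡ x) × (∀ x → g (h x) ≡ x)

  module _ (G : Subgroup) where
    open Subgroup G

    VertexTransitive : Set
    VertexTransitive = ∀ u v → ∃ λ g → Mem g × g u ≡ v

    EdgeTransitive : Set
    EdgeTransitive = ∀ u v x y → Edge u v → Edge x y → ∃ λ g → Mem g ×
      ((g u ≡ x × g v ≡ y) ⊎ (g u ≡ y × g v ≡ x))

    ArcTransitive : Set
    ArcTransitive = ∀ u v x y → Edge u v → Edge x y → ∃ λ g → Mem g ×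
      (g u ≡ x × g v ≡ y)

    HalfArcTransitive : Set
    HalfArcTransitive = VertexTransitive × EdgeTransitive × ¬ ArcTransitive

    -- D is one of the two G-arc-orbits, containing exactly one arc of each
    -- edge; D u v means u is the tail and v the head of the edge uv.
    IsOrientation : (Fin n → Fin n → Set) → Set
    IsOrientation D =
        (∀ u v → D u v → Edge u v)
      × (∀ u v → Edge u v → D u v ⊎ D v u)
      × (∀ u v → D u v → ¬ D v u)
      × (∀ g u v → Mem g → D u v → D (g u) (g v))
      × (∀ u v x y → D u v → D x y → ∃ λ g → Mem g × (g u ≡ x × g v ≡ y))

  -- G-alternating cycles of length 2r (r ≥ 2) through v, given as
  -- 2r-periodic sequences ℕ → Fin n with pairwise distinct entries on
  -- indices 0..2r-1.

  IsCycleSeq : ℕ → (ℕ → Fin n) → Set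
  IsCycleSeq r u = 2 ≤ r
    × (∀ i → u (i + 2 * r) ≡ u i)
    × (∀ i j → i < 2 * r → j < 2 * r → u i ≡ u j → i ≡ j)

  -- alternating cycle C = (u₀,…,u_{2r-1}) with u₀ = v the tail of both
  -- arcs of C at v
  AltCycleTail : (Fin n → Fin n → Set) → Fin n → ℕ → (ℕ → Fin n) → Set
  AltCycleTail D v r u = IsCycleSeq r u × u 0 ≡ v
    × (∀ k → D (u (2 * k)) (u (suc (2 * k))) × D (u (2 + 2 * k)) (u (suc (2 * k))))

  -- alternating cycle C' = (v₀,…,v_{2r-1}) with v₀ = v the head of both
  -- arcs of C' at v
  AltCycleHead : (Fin n → Fin n → Set) → Fin n → ℕ → (ℕ → Fin n) → Set
  AltCycleHead D v r w = IsCycleSeq r w × w 0 ≡ v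
    × (∀ k → D (w (suc (2 * k))) (w (2 * k)) × D (w (suc (2 * k))) (w (2 + 2 * k)))

-- number of indices i < m such that u i ∈ {w j : j < m},
-- i.e. |V(C) ∩ V(C')| for cycles of length m
interSize : {n : ℕ} → ℕ → (ℕ → Fin n) → (ℕ → Fin n) → ℕ
interSize m u w =
  length (filter (λ i → any? (λ j → u i ≟ w j) (upTo m)) (upTo m))

IsLeast : (ℕ → Set) → ℕ → Set
IsLeast P q = P q × (∀ q' → P q' → q ≤ q')

SqPM1 : ℕ → ℕ → Set
SqPM1 q a = (ℤ.+ a ℤDiv.∣ (ℤ.+ (q * q) ℤ.- ℤ.+ 1))
          ⊎ (ℤ.+ a ℤDiv.∣ (ℤ.+ (q * q) ℤ.+ ℤ.+ 1))

module Submission where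

-- Extend the alternating cycles u (v a tail) and w (v a head) to 2r-periodic sequences U, W on ℤ.
-- The four neighbours of v are U ±1 (out) and W ±1 (in), so by vertex-transitivity every vertex has
-- two out- and two in-neighbours, and an alternating walk is determined by two consecutive vertices.
-- Hence an element of G taking an arc of one alternating walk to an arc of another acts on the
-- indices as j ↦ y ± (j - z). Where U and W meet they run in opposite directions, and these maps
-- show that the indices z with U z on W form a subgroup of ℤ; counting gives ℓℤ with ℓ = 2r/a, and
-- ℓ is odd because a ∤ r. Writing U (i ℓ) = W (x ℓ), the correspondence i ↦ x is well defined
-- modulo a. The reflection of U at v, the rotation of U by 2ℓ and an element taking v to U ℓ make
-- it linear, x ≡ p i, with p² ≡ ±1 (mod a). Then q_t and q_h are both the least q ≥ 0 with
-- q ≡ ±p (mod a), so they agree, and q² ≡ p² ≡ ±1.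

open import Defs
open import Data.Fin using (Fin)

module Preliminaries where

  open import Data.Integer as ℤ
    using (ℤ; +_; -[1+_]; 0ℤ; 1ℤ; -1ℤ; _+_; _-_; _*_; -_; ∣_∣; _%ℕ_; _/ℕ_; _⊖_)
  open import Data.Integer.Properties as ℤ
    using ([+m]-[+n]≡m⊖n; ∣i∣≡0⇒i≡0; ∣m⊝n∣≤m⊔n; i-j≡0⇒i≡j; +-injective)
  open import Data.Integer.DivMod using (a≡a%ℕn+[a/ℕn]*n; n%ℕd<d)
  open import Data.Integer.Divisibility.Signed
    using (_∣_; divides; ∣m∣n⇒∣m+n; ∣m⇒∣-m; ∣n⇒∣m*n; *-monoˡ-∣; *-cancelʳ-∣; ∣⇒∣ᵤ)
  open import Data.Integer.Divisibility using () renaming (_∣_ to _∣ᵤ_)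
  open import Data.Integer.Tactic.RingSolver using (solve-∀)
  import Data.Nat.Tactic.RingSolver as ℕ-Ring
  open import Data.Nat as ℕ using (ℕ; zero; suc; NonZero)
  import Data.Nat.Properties as ℕ
  import Data.Nat.Divisibility as ℕ
  import Data.Nat.DivMod as ℕ
  open import Relation.Binary.Bundles using (Setoid)
  open import Relation.Binary.Structures using (IsEquivalence)
  open import Relation.Binary.PropositionalEquality
    using (_≡_; _≢_; refl; sym; trans; cong; cong₂; subst; subst₂; module ≡-Reasoning)
  open import Relation.Nullary using (¬_; Dec; contradiction; yes; no)
  open import Relation.Unary using (Decidable)
  open import Data.Product using (∃; _×_; _,_; proj₁; proj₂)
  open import Function using (_∘_)
  open import Data.Fin.Properties using (injective⇒≤)
  open import Data.Sum using (_⊎_; inj₁; inj₂)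
  open import Data.Empty using (⊥-elim)
  open import Data.Vec using (Vec; lookup)
  open import Data.Vec.Relation.Unary.All using (All)
  open import Data.Vec.Relation.Unary.All.Properties using (lookup⁺)
  open import Data.Vec.Relation.Unary.Unique.Propositional using (Unique)
  open import Data.Vec.Relation.Unary.Unique.Propositional.Properties using (lookup-injective)
  open import Data.List using ([]; length; filter; upTo; _++_; [_])
  open import Data.List.Properties using (upTo-∷ʳ; filter-++; length-++; filter-accept; filter-reject)

  -- Congruences of integers

  infix 4 _≡_[mod_]

  record _≡_[mod_] (x y m : ℤ) : Set where
    constructor mod-intro
    field mod-elim : m ∣ x - y
  open _≡_[mod_] public

  module _ {m : ℤ} where

    ≡-mod-reflexive : ∀ {x y} → x ≡ y → x ≡ y [mod m ]
    ≡-mod-reflexive {x} refl = mod-intro (divides 0ℤ (x-x≡0*m x m))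
      where
      x-x≡0*m : ∀ x m → x - x ≡ 0ℤ * m
      x-x≡0*m = solve-∀

    ≡-mod-refl : ∀ {x} → x ≡ x [mod m ]
    ≡-mod-refl = ≡-mod-reflexive refl

    ≡-mod-sym : ∀ {x y} → x ≡ y [mod m ] → y ≡ x [mod m ]
    ≡-mod-sym {x} {y} x≡y = mod-intro (subst (m ∣_) (-[x-y]≡y-x x y) (∣m⇒∣-m (mod-elim x≡y)))
      where
      -[x-y]≡y-x : ∀ x y → - (x - y) ≡ y - x
      -[x-y]≡y-x = solve-∀

    ≡-mod-trans : ∀ {x y z} → x ≡ y [mod m ] → y ≡ z [mod m ] → x ≡ z [mod m ]
    ≡-mod-trans {x} {y} {z} x≡y y≡z = mod-intro (subst (m ∣_) (telescope x y z) (∣m∣n⇒∣m+n (mod-elim x≡y) (mod-elim y≡z)))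
      where
      telescope : ∀ x y z → (x - y) + (y - z) ≡ x - z
      telescope = solve-∀

    ≡-mod-isEquivalence : IsEquivalence _≡_[mod m ]
    ≡-mod-isEquivalence = record
      { refl = ≡-mod-refl ; sym = ≡-mod-sym ; trans = ≡-mod-trans }

    +-cong-mod : ∀ {x x' y y'} → x ≡ x' [mod m ] → y ≡ y' [mod m ] → x + y ≡ x' + y' [mod m ]
    +-cong-mod {x} {x'} {y} {y'} p q = mod-intro (subst (m ∣_) (regroup x x' y y') (∣m∣n⇒∣m+n (mod-elim p) (mod-elim q)))
      where
      regroup : ∀ x x' y y' → (x - x') + (y - y') ≡ (x + y) - (x' + y')
      regroup = solve-∀

    +-congˡ-mod : ∀ c {y y'} → y ≡ y' [mod m ] → c + y ≡ c + y' [mod m ]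
    +-congˡ-mod c = +-cong-mod (≡-mod-refl {c})

    -‿cong-mod : ∀ {x y} → x ≡ y [mod m ] → - x ≡ - y [mod m ]
    -‿cong-mod {x} {y} p = mod-intro (subst (m ∣_) (regroup x y) (∣m⇒∣-m (mod-elim p)))
      where
      regroup : ∀ x y → - (x - y) ≡ - x - - y
      regroup = solve-∀

    *-congˡ-mod : ∀ c {x y} → x ≡ y [mod m ] → c * x ≡ c * y [mod m ]
    *-congˡ-mod c {x} {y} p = mod-intro (subst (m ∣_) (regroup c x y) (∣n⇒∣m*n c (mod-elim p)))
      where
      regroup : ∀ c x y → c * (x - y) ≡ c * x - c * y
      regroup = solve-∀

  *-cong-mod : ∀ {m x x' y y'} → x ≡ x' [mod m ] → y ≡ y' [mod m ] → x * y ≡ x' * y' [mod m ]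
  *-cong-mod {m} {x} {x'} {y} {y'} x≡x' y≡y' = ≡-mod-trans (*-congˡ-mod x y≡y')
    (subst₂ (λ a b → a ≡ b [mod m ]) (ℤ.*-comm y' x) (ℤ.*-comm y' x') (*-congˡ-mod y' x≡x'))

  ≡-mod-setoid : ℤ → Setoid _ _
  ≡-mod-setoid m = record { isEquivalence = ≡-mod-isEquivalence {m} }

  module ≡-mod-Reasoning (m : ℤ) where
    open import Relation.Binary.Reasoning.Setoid (≡-mod-setoid m) public

  *-cong-mod-scale : ∀ {m x y} k → x ≡ y [mod m ] → x * k ≡ y * k [mod m * k ]
  *-cong-mod-scale {m} {x} {y} k p = mod-intro (subst (m * k ∣_) (regroup x y k) (*-monoˡ-∣ k (mod-elim p)))
    where
    regroup : ∀ x y k → (x - y) * k ≡ x * k - y * k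
    regroup = solve-∀

  ≡-mod-*-cancelʳ : ∀ {m x y} k .{{_ : ℤ.NonZero k}} → x * k ≡ y * k [mod m * k ] → x ≡ y [mod m ]
  ≡-mod-*-cancelʳ {m} {x} {y} k p = mod-intro (*-cancelʳ-∣ k (subst (m * k ∣_) (sym (regroup x y k)) (mod-elim p)))
    where
    regroup : ∀ x y k → (x - y) * k ≡ x * k - y * k
    regroup = solve-∀

  ≡-mod-%ℕ : ∀ m .{{_ : NonZero m}} x → x ≡ + (x %ℕ m) [mod + m ]
  ≡-mod-%ℕ m x = mod-intro (divides (x /ℕ m) (remainder-form {+ (x %ℕ m)} {x /ℕ m} {+ m} x (a≡a%ℕn+[a/ℕn]*n x m)))
    where
    remainder-form : ∀ {r q k} x → x ≡ r + q * k → x - r ≡ q * k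
    remainder-form {r} {q} {k} _ refl = cancel r q k
      where
      cancel : ∀ r q k → r + q * k - r ≡ q * k
      cancel = solve-∀

  ≡-mod-small⇒≡ : ∀ {m p p'} → p ℕ.< m → p' ℕ.< m → + p ≡ + p' [mod + m ] → p ≡ p'
  ≡-mod-small⇒≡ {m} {p} {p'} p<m p'<m p≡p' with ∣ + p - + p' ∣ in eq
  ... | zero = +-injective (i-j≡0⇒i≡j (+ p) (+ p') (∣i∣≡0⇒i≡0 eq))
  ... | suc d = contradiction (ℕ.∣⇒≤ (subst (m ℕ.∣_) eq (∣⇒∣ᵤ (mod-elim p≡p')))) (ℕ.<⇒≱ d<m)
    where
    d<m : suc d ℕ.< m
    d<m = begin-strict
      suc d                 ≡⟨ eq ⟨
      ∣ + p - + p' ∣        ≡⟨ cong ∣_∣ ([+m]-[+n]≡m⊖n p p') ⟩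
      ∣ p ⊖ p' ∣            ≤⟨ ∣m⊝n∣≤m⊔n p p' ⟩
      p ℕ.⊔ p'              <⟨ ℕ.⊔-lub p<m p'<m ⟩
      m                     ∎
      where open ℕ.≤-Reasoning

  ≡0-mod⇒∣ : ∀ {d i} → + i ≡ 0ℤ [mod + d ] → d ℕ.∣ i
  ≡0-mod⇒∣ {d} {i} i≡0 = subst (d ℕ.∣_) (ℕ.+-identityʳ i) (∣⇒∣ᵤ (mod-elim i≡0))

  ∣⇒≡0-mod : ∀ {d i} → d ℕ.∣ i → + i ≡ 0ℤ [mod + d ]
  ∣⇒≡0-mod {d} {i} (ℕ.divides q i≡q*d) = mod-intro (divides (+ q) (begin
    + i - 0ℤ       ≡⟨ ℤ.+-identityʳ (+ i) ⟩
    + i            ≡⟨ cong +_ i≡q*d ⟩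
    + (q ℕ.* d)    ≡⟨ ℤ.pos-* q d ⟩
    + q * + d      ∎))
    where open ≡-Reasoning

  ≡0-mod-self : ∀ m → m ≡ 0ℤ [mod m ]
  ≡0-mod-self m = mod-intro (divides 1ℤ (trans (ℤ.+-identityʳ m) (sym (ℤ.*-identityˡ m))))

  *≡0-mod : ∀ i m → i * m ≡ 0ℤ [mod m ]
  *≡0-mod i m = mod-intro (divides i (ℤ.+-identityʳ (i * m)))

  2≡0⇒-x≡x : ∀ {m} → + 2 ≡ 0ℤ [mod m ] → ∀ x → - x ≡ x [mod m ]
  2≡0⇒-x≡x {m} 2≡0 x = begin
    - x               ≡⟨ -x≡x-x*2 x ⟩
    x - x * + 2       ≈⟨ +-congˡ-mod x (-‿cong-mod (*-congˡ-mod x 2≡0)) ⟩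
    x - x * 0ℤ        ≡⟨ x-x*0≡x x ⟩
    x                 ∎
    where
    open ≡-mod-Reasoning m
    -x≡x-x*2 : ∀ x → - x ≡ x - x * + 2
    -x≡x-x*2 = solve-∀
    x-x*0≡x : ∀ x → x - x * 0ℤ ≡ x
    x-x*0≡x = solve-∀

  IsSign : ℤ → Set
  IsSign σ = σ ≡ 1ℤ ⊎ σ ≡ -1ℤ

  sign-* : ∀ {σ τ} → IsSign σ → IsSign τ → IsSign (σ * τ)
  sign-* (inj₁ refl) (inj₁ refl) = inj₁ refl
  sign-* (inj₁ refl) (inj₂ refl) = inj₂ refl
  sign-* (inj₂ refl) (inj₁ refl) = inj₂ refl
  sign-* (inj₂ refl) (inj₂ refl) = inj₁ refl

  sign-cancel : ∀ {σ} → IsSign σ → ∀ x → σ * (σ * x) ≡ x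
  sign-cancel (inj₁ refl) x = trans (ℤ.*-identityˡ (1ℤ * x)) (ℤ.*-identityˡ x)
  sign-cancel (inj₂ refl) x = trans (ℤ.-1*i≡-i (-1ℤ * x)) (trans (cong -_ (ℤ.-1*i≡-i x)) (ℤ.neg-involutive x))

  sq≡±1⇒SqPM1 : ∀ {q a σ} → IsSign σ → + q * + q ≡ σ [mod + a ] → SqPM1 q a
  sq≡±1⇒SqPM1 {q} {a} (inj₁ refl) (mod-intro a∣) = inj₁ (subst (λ x → + a ∣ᵤ x - 1ℤ) (sym (ℤ.pos-* q q)) (∣⇒∣ᵤ a∣))
  sq≡±1⇒SqPM1 {q} {a} (inj₂ refl) (mod-intro a∣) = inj₂ (subst (λ x → + a ∣ᵤ x + 1ℤ) (sym (ℤ.pos-* q q)) (∣⇒∣ᵤ a∣))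

  least-exists : ∀ {P : ℕ → Set} → Decidable P → ∀ {N} → P N → ∃ (IsLeast P)
  least-exists P? pN with P? 0
  ... | yes p0 = 0 , p0 , λ _ _ → ℕ.z≤n
  least-exists P? {zero} pN | no ¬p0 = contradiction pN ¬p0
  least-exists P? {suc N} pN | no ¬p0 with least-exists (P? ∘ suc) pN
  ... | q , pq , least = suc q , pq , λ
    { zero p0 → contradiction p0 ¬p0
    ; (suc q') pq' → ℕ.s≤s (least q' pq') }

  module Counting {P : ℕ → Set} (P? : Decidable P) where

    count : ℕ → ℕ
    count N = length (filter P? (upTo N))

    count-suc : ∀ N → count (suc N) ≡ count N ℕ.+ length (filter P? [ N ])
    count-suc N = begin
      length (filter P? (upTo (suc N)))                ≡⟨ cong (length ∘ filter P?) (upTo-∷ʳ N) ⟨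
      length (filter P? (upTo N ++ [ N ]))             ≡⟨ cong length (filter-++ P? (upTo N) [ N ]) ⟩
      length (filter P? (upTo N) ++ filter P? [ N ])   ≡⟨ length-++ (filter P? (upTo N)) ⟩
      count N ℕ.+ length (filter P? [ N ])             ∎
      where open ≡-Reasoning

    count-accept : ∀ {N} → P N → count (suc N) ≡ suc (count N)
    count-accept {N} pN = trans (count-suc N)
      (trans (cong (λ xs → count N ℕ.+ length xs) (filter-accept P? {xs = []} pN)) (ℕ.+-comm (count N) 1))

    count-reject : ∀ {N} → ¬ P N → count (suc N) ≡ count N
    count-reject {N} ¬pN = trans (count-suc N)
      (trans (cong (λ xs → count N ℕ.+ length xs) (filter-reject P? {xs = []} ¬pN)) (ℕ.+-identityʳ (count N)))

  module _ (d : ℕ) where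
    open Counting (suc d ℕ.∣?_)

    private
      count-block : ∀ c e → e ℕ.≤ d → count (c ℕ.* suc d ℕ.+ suc e) ≡ suc (count (c ℕ.* suc d))
      count-block c zero _ = trans (cong count (ℕ.+-comm (c ℕ.* suc d) 1)) (count-accept (ℕ.divides c refl))
      count-block c (suc e) e<d = begin
        count (c ℕ.* suc d ℕ.+ suc (suc e))   ≡⟨ cong count (ℕ.+-suc (c ℕ.* suc d) (suc e)) ⟩
        count (suc (c ℕ.* suc d ℕ.+ suc e))   ≡⟨ count-reject ∤ ⟩
        count (c ℕ.* suc d ℕ.+ suc e)         ≡⟨ count-block c e (ℕ.<⇒≤ e<d) ⟩
        suc (count (c ℕ.* suc d))             ∎
        where
        open ≡-Reasoning
        ∤ : ¬ (suc d ℕ.∣ c ℕ.* suc d ℕ.+ suc e)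
        ∤ d∣ = ℕ.<⇒≱ (ℕ.s≤s e<d) (ℕ.∣⇒≤ (ℕ.∣m+n∣m⇒∣n d∣ (ℕ.divides c refl)))

    count-multiples : ∀ c → count (c ℕ.* suc d) ≡ c
    count-multiples zero = refl
    count-multiples (suc c) = begin
      count (suc d ℕ.+ c ℕ.* suc d)   ≡⟨ cong count (ℕ.+-comm (suc d) (c ℕ.* suc d)) ⟩
      count (c ℕ.* suc d ℕ.+ suc d)   ≡⟨ count-block c d ℕ.≤-refl ⟩
      suc (count (c ℕ.* suc d))       ≡⟨ cong suc (count-multiples c) ⟩
      suc c                           ∎
      where open ≡-Reasoning

  cofactor-unique : ∀ {a x y n} → a ℕ.* x ≡ suc n → a ℕ.* y ≡ suc n → x ≡ y
  cofactor-unique {suc a} {x} {y} ax≡ ay≡ = ℕ.*-cancelˡ-≡ x y (suc a) (trans ax≡ (sym ay≡))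

  odd-cofactor : ∀ {a ℓ r} → a ℕ.* ℓ ≡ 2 ℕ.* r → ¬ (a ℕ.∣ r) → ∃ λ k → ℓ ≡ suc (2 ℕ.* k)
  odd-cofactor {a} {ℓ} {r} a*ℓ≡2r a∤r = by-parity (ℓ ℕ.% 2) refl (ℕ.m%n<n ℓ 2)
    where
    h : ℕ
    h = ℓ ℕ./ 2

    by-parity : ∀ t → ℓ ℕ.% 2 ≡ t → t ℕ.< 2 → ∃ λ k → ℓ ≡ suc (2 ℕ.* k)
    by-parity 0 ℓ%2≡0 _ = contradiction (ℕ.divides h (ℕ.*-cancelˡ-≡ r (h ℕ.* a) 2 (begin
      2 ℕ.* r                 ≡⟨ a*ℓ≡2r ⟨
      a ℕ.* ℓ                 ≡⟨ cong (a ℕ.*_) (trans (ℕ.m≡m%n+[m/n]*n ℓ 2) (cong (ℕ._+ h ℕ.* 2) ℓ%2≡0)) ⟩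
      a ℕ.* (0 ℕ.+ h ℕ.* 2)   ≡⟨ regroup a h ⟩
      2 ℕ.* (h ℕ.* a)         ∎))) a∤r
      where
      open ≡-Reasoning
      regroup : ∀ a h → a ℕ.* (0 ℕ.+ h ℕ.* 2) ≡ 2 ℕ.* (h ℕ.* a)
      regroup = ℕ-Ring.solve-∀
    by-parity 1 ℓ%2≡1 _ = h , trans (ℕ.m≡m%n+[m/n]*n ℓ 2) (cong₂ ℕ._+_ ℓ%2≡1 (ℕ.*-comm h 2))
    by-parity (suc (suc _)) _ (ℕ.s≤s (ℕ.s≤s ()))

  -- Integer-indexed sequences

  even-or-odd : ∀ z → ∃ λ k → z ≡ + 2 * k ⊎ z ≡ 1ℤ + + 2 * k
  even-or-odd z with z %ℕ 2 | n%ℕd<d z 2 | a≡a%ℕn+[a/ℕn]*n z 2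
  ... | 0 | _ | z≡0+q*2 = z /ℕ 2 , inj₁ (trans z≡0+q*2 (0+q*2≡2*q (z /ℕ 2)))
    where
    0+q*2≡2*q : ∀ q → 0ℤ + q * + 2 ≡ + 2 * q
    0+q*2≡2*q = solve-∀
  ... | 1 | _ | z≡1+q*2 = z /ℕ 2 , inj₂ (trans z≡1+q*2 (cong (λ x → 1ℤ + x) (ℤ.*-comm (z /ℕ 2) (+ 2))))
  ... | suc (suc _) | ℕ.s≤s (ℕ.s≤s ()) | _

  module PeriodicExtension {A : Set} (m : ℕ) .{{_ : NonZero m}}
    (s : ℕ → A) (periodic : ∀ i → s (i ℕ.+ m) ≡ s i) where

    periodic-* : ∀ i k → s (i ℕ.+ k ℕ.* m) ≡ s i
    periodic-* i zero = cong s (ℕ.+-identityʳ i)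
    periodic-* i (suc k) = begin
      s (i ℕ.+ (m ℕ.+ k ℕ.* m))   ≡⟨ cong s (ℕ.+-assoc i m (k ℕ.* m)) ⟨
      s (i ℕ.+ m ℕ.+ k ℕ.* m)     ≡⟨ periodic-* (i ℕ.+ m) k ⟩
      s (i ℕ.+ m)                 ≡⟨ periodic i ⟩
      s i                         ∎
      where open ≡-Reasoning

    opaque
      extend : ℤ → A
      extend z = s (z %ℕ m)

      extend-+ : ∀ i → extend (+ i) ≡ s i
      extend-+ i = begin
        s (i ℕ.% m)                            ≡⟨ periodic-* (i ℕ.% m) (i ℕ./ m) ⟨
        s (i ℕ.% m ℕ.+ i ℕ./ m ℕ.* m)          ≡⟨ cong s (ℕ.m≡m%n+[m/n]*n i m) ⟨
        s i                                    ∎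
        where open ≡-Reasoning

      extend-cong : ∀ {x y} → x ≡ y [mod + m ] → extend x ≡ extend y
      extend-cong {x} {y} x≡y = cong s (≡-mod-small⇒≡ (n%ℕd<d x m) (n%ℕd<d y m)
        (≡-mod-trans (≡-mod-sym (≡-mod-%ℕ m x)) (≡-mod-trans x≡y (≡-mod-%ℕ m y))))

      extend-injective : (∀ i j → i ℕ.< m → j ℕ.< m → s i ≡ s j → i ≡ j) →
                         ∀ {x y} → extend x ≡ extend y → x ≡ y [mod + m ]
      extend-injective injective {x} {y} eq = ≡-mod-trans (≡-mod-%ℕ m x)
        (≡-mod-trans (≡-mod-reflexive (cong +_ (injective _ _ (n%ℕd<d x m) (n%ℕd<d y m) eq)))
                     (≡-mod-sym (≡-mod-%ℕ m y)))

  module CyclicSubgroup {P : ℤ → Set} (P-0 : P 0ℤ) (P-+ : ∀ {a b} → P a → P b → P (a + b))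
    (P-neg : ∀ {a} → P a → P (- a)) (P-pos? : ∀ i → Dec (P (+ suc i))) where

    P-*ℕ : ∀ k {a} → P a → P (+ k * a)
    P-*ℕ zero {a} _ = subst P (sym (ℤ.*-zeroˡ a)) P-0
    P-*ℕ (suc k) {a} pa = subst P (a+k*a≡[1+k]*a (+ k) a) (P-+ pa (P-*ℕ k pa))
      where
      a+k*a≡[1+k]*a : ∀ k a → a + k * a ≡ (1ℤ + k) * a
      a+k*a≡[1+k]*a = solve-∀

    P-* : ∀ k {a} → P a → P (k * a)
    P-* (+ k) pa = P-*ℕ k pa
    P-* -[1+ k ] {a} pa = subst P (ℤ.neg-distribˡ-* (+ suc k) a) (P-neg (P-*ℕ (suc k) pa))

    generator : ∀ {N} → P (+ suc N) →
      ∃ λ d → ∀ t → (P t → t ≡ 0ℤ [mod + suc d ]) × (t ≡ 0ℤ [mod + suc d ] → P t)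
    generator pN with least-exists P-pos? pN
    ... | d , pd , least = d , λ t → only-multiples t , multiples t
      where
      D : ℕ
      D = suc d

      multiples : ∀ t → t ≡ 0ℤ [mod + D ] → P t
      multiples t (mod-intro (divides k t-0≡k*D)) = subst P (trans (sym t-0≡k*D) (ℤ.+-identityʳ t)) (P-* k pd)

      remainder : ∀ t → P t → P (+ (t %ℕ D))
      remainder t pt = subst P (t-q*D≡r {q = t /ℕ D} t (a≡a%ℕn+[a/ℕn]*n t D)) (P-+ pt (P-* (- (t /ℕ D)) pd))
        where
        t-q*D≡r : ∀ {r q} t → t ≡ r + q * + D → t + - q * + D ≡ r
        t-q*D≡r {r} {q} _ refl = cancel r q (+ D)
          where
          cancel : ∀ r q d → r + q * d + - q * d ≡ r
          cancel = solve-∀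

      only-multiples : ∀ t → P t → t ≡ 0ℤ [mod + D ]
      only-multiples t pt with t %ℕ D in r≡ | remainder t pt
      ... | zero | _ = ≡-mod-trans (≡-mod-%ℕ D t) (≡-mod-reflexive (cong +_ r≡))
      ... | suc e | pe = contradiction (least e pe) (ℕ.<⇒≱ (ℕ.s≤s⁻¹ (subst (ℕ._< D) r≡ (n%ℕd<d t D))))

  -- Pigeonhole arguments

  distinct-in-image-length≤ : ∀ {X : Set} {k m} (f : Fin k → X) {xs : Vec X m} →
    Unique xs → All (λ x → ∃ λ i → f i ≡ x) xs → m ℕ.≤ k
  distinct-in-image-length≤ f {xs} distinct inImage = injective⇒≤ {f = preimage} preimage-injective
    where
    preimage : Fin _ → Fin _
    preimage j = proj₁ (lookup⁺ inImage j)

    preimage-injective : ∀ {i j} → preimage i ≡ preimage j → i ≡ j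
    preimage-injective {i} {j} eq = lookup-injective distinct i j (begin
      lookup xs i       ≡⟨ proj₂ (lookup⁺ inImage i) ⟨
      f (preimage i)    ≡⟨ cong f eq ⟩
      f (preimage j)    ≡⟨ proj₂ (lookup⁺ inImage j) ⟩
      lookup xs j       ∎)
      where open ≡-Reasoning

  pigeonhole₂ : ∀ {X Y : Set} {a b : X} (g : Y → X) → (∀ {x y} → g x ≡ g y → x ≡ y) →
    ∀ {y₁ y₂ y₃} → g y₁ ≡ a ⊎ g y₁ ≡ b → g y₂ ≡ a ⊎ g y₂ ≡ b → g y₃ ≡ a ⊎ g y₃ ≡ b →
    y₁ ≢ y₂ → y₃ ≡ y₁ ⊎ y₃ ≡ y₂
  pigeonhole₂ g inj (inj₁ p) (inj₁ q) _ y₁≢y₂ = ⊥-elim (y₁≢y₂ (inj (trans p (sym q))))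
  pigeonhole₂ g inj (inj₂ p) (inj₂ q) _ y₁≢y₂ = ⊥-elim (y₁≢y₂ (inj (trans p (sym q))))
  pigeonhole₂ g inj (inj₁ p) _ (inj₁ r) _ = inj₁ (inj (trans r (sym p)))
  pigeonhole₂ g inj (inj₂ p) _ (inj₂ r) _ = inj₁ (inj (trans r (sym p)))
  pigeonhole₂ g inj (inj₁ _) (inj₂ q) (inj₂ r) _ = inj₂ (inj (trans r (sym q)))
  pigeonhole₂ g inj (inj₂ _) (inj₁ q) (inj₁ r) _ = inj₂ (inj (trans r (sym q)))

module OrientedGraph {n} (Γ : Graph n) (G : Subgroup Γ) (tetravalent : Tetravalent Γ)
  (vertex-transitive : VertexTransitive Γ G)
  {D : Fin n → Fin n → Set} (orientation : IsOrientation Γ G D) where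

  open import Data.Integer as ℤ using (ℤ; +_; -[1+_]; 0ℤ; 1ℤ; -1ℤ; _+_; _-_; _*_; -_; _%ℕ_)
  import Data.Integer.Properties as ℤ
  open import Data.Integer.DivMod using (n%ℕd<d)
  open import Data.Integer.Divisibility.Signed using (divides)
  open import Data.Integer.Tactic.RingSolver using (solve-∀)
  open import Data.Nat as ℕ using (ℕ; zero; suc)
  import Data.Nat.Properties as ℕ
  import Data.Nat.Divisibility as ℕ
  open import Relation.Binary.PropositionalEquality
    using (_≡_; _≢_; refl; sym; trans; cong; subst; subst₂; module ≡-Reasoning)
  open import Relation.Nullary using (¬_; contradiction; yes; no)
  open import Relation.Nullary.Decidable using (map′)
  open import Data.Product using (∃; _×_; _,_; proj₁; proj₂)
  open import Function using (_∘_; flip)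
  open import Data.Fin.Properties using () renaming (_≟_ to _≟ᶠ_)
  open import Data.Sum using (_⊎_; inj₁; inj₂)
  open import Data.Vec.Relation.Unary.All using ([]; _∷_)
  open import Data.Vec.Relation.Unary.AllPairs using ([]; _∷_)
  open import Data.List using (length; filter; upTo)
  open import Data.List.Properties using (filter-≐)
  open import Data.List.Relation.Unary.Any using (Any; any?)
  open import Data.List.Membership.Propositional using (find; lose)
  open import Data.List.Membership.Propositional.Properties using (∈-upTo⁺)

  open Preliminaries

  open Graph Γ
  open Subgroup G

  arc⇒edge : ∀ {x y} → D x y → Edge Γ x y
  arc⇒edge = proj₁ orientation _ _

  arc-asym : ∀ {x y} → D x y → ¬ D y x
  arc-asym = proj₁ (proj₂ (proj₂ orientation)) _ _

  arc-preserved : ∀ {g x y} → Mem g → D x y → D (g x) (g y)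
  arc-preserved {g} = proj₁ (proj₂ (proj₂ (proj₂ orientation))) g _ _

  arc-transitive : ∀ {x y x' y'} → D x y → D x' y' → ∃ λ g → Mem g × g x ≡ x' × g y ≡ y'
  arc-transitive = proj₂ (proj₂ (proj₂ (proj₂ orientation))) _ _ _ _

  member-injective : ∀ {g} → Mem g → ∀ {x y} → g x ≡ g y → x ≡ y
  member-injective {g} g∈G {x} {y} eq with aut g g∈G
  ... | (g⁻¹ , g⁻¹∘g≗id , _) , _ = trans (sym (g⁻¹∘g≗id x)) (trans (cong g⁻¹ eq) (g⁻¹∘g≗id y))

  OutDegree≤2 InDegree≤2 : Set
  OutDegree≤2 = ∀ {x y₁ y₂ y₃} → D x y₁ → D x y₂ → D x y₃ → y₁ ≢ y₂ → y₃ ≡ y₁ ⊎ y₃ ≡ y₂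
  InDegree≤2 = ∀ {x y₁ y₂ y₃} → D y₁ x → D y₂ x → D y₃ x → y₁ ≢ y₂ → y₃ ≡ y₁ ⊎ y₃ ≡ y₂

  module DegreeTwo {v a₁ a₂ b₁ b₂} (out₁ : D v a₁) (out₂ : D v a₂) (in₁ : D b₁ v) (in₂ : D b₂ v)
    (a₁≢a₂ : a₁ ≢ a₂) (b₁≢b₂ : b₁ ≢ b₂) where

    private
      out≢in : ∀ {x y} → D v x → D y v → x ≢ y
      out≢in vx yv refl = arc-asym vx yv

      edge-of-in : ∀ {x} → D x v → Edge Γ v x
      edge-of-in {x} xv = trans (adj-sym v x) (arc⇒edge xv)

      neighbour : Fin 4 → Fin n
      neighbour = proj₁ (tetravalent v)

      neighbour-covers : ∀ {x} → Edge Γ v x → ∃ λ i → neighbour i ≡ x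
      neighbour-covers = proj₂ (proj₂ (proj₂ (tetravalent v))) _

    neighbour-cases : ∀ {z} → Edge Γ v z → z ≡ a₁ ⊎ z ≡ a₂ ⊎ z ≡ b₁ ⊎ z ≡ b₂
    neighbour-cases {z} vz with z ≟ᶠ a₁ | z ≟ᶠ a₂ | z ≟ᶠ b₁ | z ≟ᶠ b₂
    ... | yes p | _     | _     | _     = inj₁ p
    ... | no _  | yes p | _     | _     = inj₂ (inj₁ p)
    ... | no _  | no _  | yes p | _     = inj₂ (inj₂ (inj₁ p))
    ... | no _  | no _  | no _  | yes p = inj₂ (inj₂ (inj₂ p))
    ... | no p₁ | no p₂ | no p₃ | no p₄ = contradiction
      (distinct-in-image-length≤ neighbour
        ((p₁ ∷ p₂ ∷ p₃ ∷ p₄ ∷ [])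
          ∷ (a₁≢a₂ ∷ out≢in out₁ in₁ ∷ out≢in out₁ in₂ ∷ [])
          ∷ (out≢in out₂ in₁ ∷ out≢in out₂ in₂ ∷ [])
          ∷ (b₁≢b₂ ∷ [])
          ∷ [] ∷ [])
        (neighbour-covers vz
          ∷ neighbour-covers (arc⇒edge out₁) ∷ neighbour-covers (arc⇒edge out₂)
          ∷ neighbour-covers (edge-of-in in₁) ∷ neighbour-covers (edge-of-in in₂) ∷ []))
      (ℕ.<-irrefl refl)

    out-of-v : ∀ {z} → D v z → z ≡ a₁ ⊎ z ≡ a₂
    out-of-v vz with neighbour-cases (arc⇒edge vz)
    ... | inj₁ p = inj₁ p
    ... | inj₂ (inj₁ p) = inj₂ p
    ... | inj₂ (inj₂ (inj₁ p)) = contradiction p (out≢in vz in₁)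
    ... | inj₂ (inj₂ (inj₂ p)) = contradiction p (out≢in vz in₂)

    in-of-v : ∀ {z} → D z v → z ≡ b₁ ⊎ z ≡ b₂
    in-of-v zv with neighbour-cases (edge-of-in zv)
    ... | inj₁ p = contradiction (sym p) (out≢in out₁ zv)
    ... | inj₂ (inj₁ p) = contradiction (sym p) (out≢in out₂ zv)
    ... | inj₂ (inj₂ (inj₁ p)) = inj₁ p
    ... | inj₂ (inj₂ (inj₂ p)) = inj₂ p

    out-degree≤2 : OutDegree≤2
    out-degree≤2 {x} xy₁ xy₂ xy₃ = pigeonhole₂ g (member-injective g∈G) (moved xy₁) (moved xy₂) (moved xy₃)
      where
      g : Fin n → Fin n
      g = proj₁ (vertex-transitive x v)
      g∈G : Mem g
      g∈G = proj₁ (proj₂ (vertex-transitive x v))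
      moved : ∀ {y} → D x y → g y ≡ a₁ ⊎ g y ≡ a₂
      moved {y} xy = out-of-v (subst (λ t → D t (g y)) (proj₂ (proj₂ (vertex-transitive x v))) (arc-preserved g∈G xy))

    in-degree≤2 : InDegree≤2
    in-degree≤2 {x} y₁x y₂x y₃x = pigeonhole₂ g (member-injective g∈G) (moved y₁x) (moved y₂x) (moved y₃x)
      where
      g : Fin n → Fin n
      g = proj₁ (vertex-transitive x v)
      g∈G : Mem g
      g∈G = proj₁ (proj₂ (vertex-transitive x v))
      moved : ∀ {y} → D y x → g y ≡ b₁ ⊎ g y ≡ b₂
      moved {y} yx = in-of-v (subst (D (g y)) (proj₂ (proj₂ (vertex-transitive x v))) (arc-preserved g∈G yx))

  -- Alternating walks

  Alternates : Fin n → Fin n → Fin n → Set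
  Alternates a p b = (D a p × D b p) ⊎ (D p a × D p b)

  alternates-sym : ∀ {a p b} → Alternates a p b → Alternates b p a
  alternates-sym (inj₁ (ap , bp)) = inj₁ (bp , ap)
  alternates-sym (inj₂ (pa , pb)) = inj₂ (pb , pa)

  alternates-preserved : ∀ {g a p b} → Mem g → Alternates a p b → Alternates (g a) (g p) (g b)
  alternates-preserved g∈G (inj₁ (ap , bp)) = inj₁ (arc-preserved g∈G ap , arc-preserved g∈G bp)
  alternates-preserved g∈G (inj₂ (pa , pb)) = inj₂ (arc-preserved g∈G pa , arc-preserved g∈G pb)

  record AlternatingWalk (s : ℤ → Fin n) : Set where
    field
      alternates   : ∀ z → Alternates (s z) (s (1ℤ + z)) (s (+ 2 + z))
      nonreturning : ∀ z → s z ≢ s (+ 2 + z)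

  open AlternatingWalk

  Out In : (ℤ → Fin n) → ℤ → Set
  Out s z = D (s z) (s (1ℤ + z))
  In s z = D (s (1ℤ + z)) (s z)

  out-or-in : ∀ {s} → AlternatingWalk s → ∀ z → Out s z ⊎ In s z
  out-or-in walk z with alternates walk z
  ... | inj₁ (out , _) = inj₁ out
  ... | inj₂ (in′ , _) = inj₂ in′

  data SameDirection (s : ℤ → Fin n) (z : ℤ) (t : ℤ → Fin n) (y : ℤ) : Set where
    both-out : Out s z → Out t y → SameDirection s z t y
    both-in  : In s z → In t y → SameDirection s z t y

  shift-arc : ∀ (R : Fin n → Fin n → Set) (f : ℤ → Fin n) c →
    R (f c) (f (1ℤ + c)) → R (f (c + 0ℤ)) (f (c + 1ℤ))
  shift-arc R f c = subst₂ (λ a b → R (f a) (f b)) (sym (ℤ.+-identityʳ c)) (ℤ.+-comm 1ℤ c)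

  reverse-walk : ∀ {t} → AlternatingWalk t → AlternatingWalk (t ∘ -_)
  reverse-walk {t} walk = record
    { alternates = λ z → subst₂ (λ a p → Alternates a p (t (- (+ 2 + z))))
        (cong t (2+[-[2+z]]≡-z z)) (cong t (1+[-[2+z]]≡-[1+z] z))
        (alternates-sym (alternates walk (- (+ 2 + z))))
    ; nonreturning = λ z eq → nonreturning walk (- (+ 2 + z))
        (trans (sym eq) (cong t (sym (2+[-[2+z]]≡-z z))))
    }
    where
    1+[-[2+z]]≡-[1+z] : ∀ z → 1ℤ + - (+ 2 + z) ≡ - (1ℤ + z)
    1+[-[2+z]]≡-[1+z] = solve-∀
    2+[-[2+z]]≡-z : ∀ z → + 2 + - (+ 2 + z) ≡ - z
    2+[-[2+z]]≡-z = solve-∀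

  shift-walk : ∀ {t} c → AlternatingWalk t → AlternatingWalk (λ z → t (c + z))
  shift-walk {t} c walk = record
    { alternates = λ z → subst₂ (Alternates (t (c + z)))
        (cong t (k+[c+z]≡c+[k+z] c 1ℤ z)) (cong t (k+[c+z]≡c+[k+z] c (+ 2) z))
        (alternates walk (c + z))
    ; nonreturning = λ z eq → nonreturning walk (c + z) (trans eq (cong t (sym (k+[c+z]≡c+[k+z] c (+ 2) z))))
    }
    where
    k+[c+z]≡c+[k+z] : ∀ c k z → k + (c + z) ≡ c + (k + z)
    k+[c+z]≡c+[k+z] = solve-∀

  image-walk : ∀ {g t} → Mem g → AlternatingWalk t → AlternatingWalk (g ∘ t)
  image-walk g∈G walk = record
    { alternates = λ z → alternates-preserved g∈G (alternates walk z)
    ; nonreturning = λ z eq → nonreturning walk z (member-injective g∈G eq)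
    }

  module Walks (out-degree≤2 : OutDegree≤2) (in-degree≤2 : InDegree≤2) where

    private
      z+[j-z]≡j : ∀ z j → z + (j - z) ≡ j
      z+[j-z]≡j = solve-∀

    alternates-unique : ∀ {a p b b'} → Alternates a p b → Alternates a p b' → a ≢ b → a ≢ b' → b ≡ b'
    alternates-unique {a} {b = b} {b'} (inj₁ (ap , bp)) (inj₁ (_ , b'p)) a≢b a≢b' = other (in-degree≤2 ap bp b'p a≢b)
      where
      other : b' ≡ a ⊎ b' ≡ b → b ≡ b'
      other (inj₁ b'≡a) = contradiction (sym b'≡a) a≢b'
      other (inj₂ b'≡b) = sym b'≡b
    alternates-unique {a} {b = b} {b'} (inj₂ (pa , pb)) (inj₂ (_ , pb')) a≢b a≢b' = other (out-degree≤2 pa pb pb' a≢b)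
      where
      other : b' ≡ a ⊎ b' ≡ b → b ≡ b'
      other (inj₁ b'≡a) = contradiction (sym b'≡a) a≢b'
      other (inj₂ b'≡b) = sym b'≡b
    alternates-unique (inj₁ (ap , _)) (inj₂ (pa , _)) _ _ = contradiction pa (arc-asym ap)
    alternates-unique (inj₂ (pa , _)) (inj₁ (ap , _)) _ _ = contradiction pa (arc-asym ap)

    walks-agree : ∀ {s t} → AlternatingWalk s → AlternatingWalk t →
                  s 0ℤ ≡ t 0ℤ → s 1ℤ ≡ t 1ℤ → ∀ z → s z ≡ t z
    walks-agree {s} {t} walk-s walk-t s₀≡t₀ s₁≡t₁ = agree
      where
      forward : ∀ {s t} → AlternatingWalk s → AlternatingWalk t → s 0ℤ ≡ t 0ℤ → s 1ℤ ≡ t 1ℤ →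
                ∀ k → s (+ k) ≡ t (+ k) × s (+ suc k) ≡ t (+ suc k)
      forward _ _ s₀≡t₀ s₁≡t₁ zero = s₀≡t₀ , s₁≡t₁
      forward {s} {t} walk-s walk-t s₀≡t₀ s₁≡t₁ (suc k) with forward walk-s walk-t s₀≡t₀ s₁≡t₁ k
      ... | sₖ≡tₖ , sₖ₊₁≡tₖ₊₁ = sₖ₊₁≡tₖ₊₁ , alternates-unique (alternates walk-s (+ k))
        (subst₂ (λ a p → Alternates a p (t (+ suc (suc k)))) (sym sₖ≡tₖ) (sym sₖ₊₁≡tₖ₊₁) (alternates walk-t (+ k)))
        (nonreturning walk-s (+ k)) (λ eq → nonreturning walk-t (+ k) (trans (sym sₖ≡tₖ) eq))

      s₋₁≡t₋₁ : s -1ℤ ≡ t -1ℤ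
      s₋₁≡t₋₁ = alternates-unique
        (alternates-sym (alternates walk-s -1ℤ))
        (subst₂ (λ a p → Alternates a p (t -1ℤ)) (sym s₁≡t₁) (sym s₀≡t₀) (alternates-sym (alternates walk-t -1ℤ)))
        (λ eq → nonreturning walk-s -1ℤ (sym eq)) (λ eq → nonreturning walk-t -1ℤ (trans (sym eq) s₁≡t₁))

      agree : ∀ z → s z ≡ t z
      agree (+ k) = proj₁ (forward walk-s walk-t s₀≡t₀ s₁≡t₁ k)
      agree -[1+ k ] = proj₂ (forward (reverse-walk walk-s) (reverse-walk walk-t) s₀≡t₀ s₋₁≡t₋₁ k)

    sign-reparametrisation : ∀ {s t} → AlternatingWalk s → AlternatingWalk t → s 0ℤ ≡ t 0ℤ →
      SameDirection s 0ℤ t 0ℤ → ∃ λ σ → IsSign σ × ∀ z → s z ≡ t (σ * z)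
    sign-reparametrisation {s} {t} walk-s walk-t s₀≡t₀ same = reparametrise (s₁-cases same (alternates walk-t -1ℤ))
      where
      t₁≢t₋₁ : t 1ℤ ≢ t -1ℤ
      t₁≢t₋₁ eq = nonreturning walk-t -1ℤ (sym eq)

      s₁-cases : SameDirection s 0ℤ t 0ℤ → Alternates (t -1ℤ) (t 0ℤ) (t 1ℤ) → s 1ℤ ≡ t 1ℤ ⊎ s 1ℤ ≡ t -1ℤ
      s₁-cases (both-out _ t₀t₁) (inj₁ (_ , t₁t₀)) = contradiction t₁t₀ (arc-asym t₀t₁)
      s₁-cases (both-out s₀s₁ t₀t₁) (inj₂ (t₀t₋₁ , _)) =
        out-degree≤2 t₀t₁ t₀t₋₁ (subst (λ a → D a (s 1ℤ)) s₀≡t₀ s₀s₁) t₁≢t₋₁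
      s₁-cases (both-in _ t₁t₀) (inj₂ (_ , t₀t₁)) = contradiction t₁t₀ (arc-asym t₀t₁)
      s₁-cases (both-in s₁s₀ t₁t₀) (inj₁ (t₋₁t₀ , _)) =
        in-degree≤2 t₁t₀ t₋₁t₀ (subst (D (s 1ℤ)) s₀≡t₀ s₁s₀) t₁≢t₋₁

      reparametrise : s 1ℤ ≡ t 1ℤ ⊎ s 1ℤ ≡ t -1ℤ → ∃ λ σ → IsSign σ × ∀ z → s z ≡ t (σ * z)
      reparametrise (inj₁ s₁≡t₁) = 1ℤ , inj₁ refl , λ z →
        trans (walks-agree walk-s walk-t s₀≡t₀ s₁≡t₁ z) (cong t (sym (ℤ.*-identityˡ z)))
      reparametrise (inj₂ s₁≡t₋₁) = -1ℤ , inj₂ refl , λ z →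
        trans (walks-agree walk-s (reverse-walk walk-t) s₀≡t₀ s₁≡t₋₁ z) (cong t (sym (ℤ.-1*i≡-i z)))

    image-of-walk : ∀ {g s t z y} → Mem g → AlternatingWalk s → AlternatingWalk t → g (s z) ≡ t y →
      SameDirection s z t y → ∃ λ σ → IsSign σ × ∀ j → g (s j) ≡ t (y + σ * (j - z))
    image-of-walk {g} {s} {t} {z} {y} g∈G walk-s walk-t gs≡t same
      with sign-reparametrisation (image-walk g∈G (shift-walk z walk-s)) (shift-walk y walk-t) start (shift-same same)
      where
      start : g (s (z + 0ℤ)) ≡ t (y + 0ℤ)
      start = subst₂ (λ a b → g (s a) ≡ t b) (sym (ℤ.+-identityʳ z)) (sym (ℤ.+-identityʳ y)) gs≡t
      shift-same : SameDirection s z t y → SameDirection (λ j → g (s (z + j))) 0ℤ (λ j → t (y + j)) 0ℤ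
      shift-same (both-out out-s out-t) = both-out (shift-arc D (g ∘ s) z (arc-preserved g∈G out-s)) (shift-arc D t y out-t)
      shift-same (both-in in-s in-t) =
        both-in (shift-arc (flip D) (g ∘ s) z (arc-preserved g∈G in-s)) (shift-arc (flip D) t y in-t)
    ... | σ , sign , along = σ , sign , λ j → trans (cong (g ∘ s) (sym (z+[j-z]≡j z j))) (along (j - z))

    walk-translation : ∀ {s t z y} → AlternatingWalk s → AlternatingWalk t →
      SameDirection s z t y → ∃ λ g → Mem g × ∀ j → g (s j) ≡ t (y + (j - z))
    walk-translation {s} {t} {z} {y} walk-s walk-t same with arc-map same
      where
      arc-map : SameDirection s z t y → ∃ λ g → Mem g × g (s z) ≡ t y × g (s (1ℤ + z)) ≡ t (1ℤ + y)
      arc-map (both-out out-s out-t) = arc-transitive out-s out-t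
      arc-map (both-in in-s in-t) with arc-transitive in-s in-t
      ... | g , g∈G , g₁ , g₀ = g , g∈G , g₀ , g₁
    ... | g , g∈G , g₀ , g₁ = g , g∈G , λ j →
      trans (cong (g ∘ s) (sym (z+[j-z]≡j z j)))
            (walks-agree (image-walk g∈G (shift-walk z walk-s)) (shift-walk y walk-t)
               (subst₂ (λ a b → g (s a) ≡ t b) (sym (ℤ.+-identityʳ z)) (sym (ℤ.+-identityʳ y)) g₀)
               (subst₂ (λ a b → g (s a) ≡ t b) (ℤ.+-comm 1ℤ z) (ℤ.+-comm 1ℤ y) g₁)
               (j - z))

    private
      j-0≡j : ∀ j → j - 0ℤ ≡ j
      j-0≡j j = ℤ.+-identityʳ j

    image-of-walk₀ : ∀ {g s t y} → Mem g → AlternatingWalk s → AlternatingWalk t → g (s 0ℤ) ≡ t y →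
      SameDirection s 0ℤ t y → ∃ λ σ → IsSign σ × ∀ j → g (s j) ≡ t (y + σ * j)
    image-of-walk₀ {t = t} {y} g∈G walk-s walk-t gs≡t same with image-of-walk g∈G walk-s walk-t gs≡t same
    ... | σ , σ-sign , along = σ , σ-sign , λ j → trans (along j) (cong (λ i → t (y + σ * i)) (j-0≡j j))

    walk-translation₀ : ∀ {s t y} → AlternatingWalk s → AlternatingWalk t →
      SameDirection s 0ℤ t y → ∃ λ g → Mem g × ∀ j → g (s j) ≡ t (y + j)
    walk-translation₀ {t = t} {y} walk-s walk-t same with walk-translation walk-s walk-t same
    ... | g , g∈G , along = g , g∈G , λ j → trans (along j) (cong (λ i → t (y + i)) (j-0≡j j))

  module AlternatingCycles (v : Fin n) (r′ : ℕ) (u w : ℕ → Fin n)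
    (u-cycle : AltCycleTail Γ D v (suc (suc r′)) u) (w-cycle : AltCycleHead Γ D v (suc (suc r′)) w) where

    r m : ℕ
    r = suc (suc r′)
    m = 2 ℕ.* r

    open PeriodicExtension m u (proj₁ (proj₂ (proj₁ u-cycle)))
      renaming (extend to U; extend-+ to U-+; extend-cong to U-cong; extend-injective to U-injective′)
    open PeriodicExtension m w (proj₁ (proj₂ (proj₁ w-cycle)))
      renaming (extend to W; extend-+ to W-+; extend-cong to W-cong; extend-injective to W-injective′)

    U-injective : ∀ {x y} → U x ≡ U y → x ≡ y [mod + m ]
    U-injective = U-injective′ (proj₂ (proj₂ (proj₁ u-cycle)))

    W-injective : ∀ {x y} → W x ≡ W y → x ≡ y [mod + m ]
    W-injective = W-injective′ (proj₂ (proj₂ (proj₁ w-cycle)))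

    U₀≡v : U 0ℤ ≡ v
    U₀≡v = trans (U-+ 0) (proj₁ (proj₂ u-cycle))

    W₀≡v : W 0ℤ ≡ v
    W₀≡v = trans (W-+ 0) (proj₁ (proj₂ w-cycle))

    private
      2k≡2[k%r] : ∀ k → + 2 * k ≡ + (2 ℕ.* (k %ℕ r)) [mod + m ]
      2k≡2[k%r] k = subst₂ (λ a b → + 2 * k ≡ a [mod b ])
        (trans (ℤ.*-comm (+ (k %ℕ r)) (+ 2)) (sym (ℤ.pos-* 2 (k %ℕ r))))
        (trans (ℤ.*-comm (+ r) (+ 2)) (sym (ℤ.pos-* 2 r)))
        (subst (λ a → a ≡ + (k %ℕ r) * + 2 [mod + r * + 2 ]) (ℤ.*-comm k (+ 2))
          (*-cong-mod-scale (+ 2) (≡-mod-%ℕ r k)))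

      U-at : ∀ {z i} → z ≡ + i [mod + m ] → U z ≡ u i
      U-at {i = i} z≡i = trans (U-cong z≡i) (U-+ i)

      W-at : ∀ {z i} → z ≡ + i [mod + m ] → W z ≡ w i
      W-at {i = i} z≡i = trans (W-cong z≡i) (W-+ i)

      1+ : ∀ {x y} → x ≡ y [mod + m ] → 1ℤ + x ≡ 1ℤ + y [mod + m ]
      1+ = +-congˡ-mod 1ℤ

    U-out-even : ∀ k → Out U (+ 2 * k)
    U-out-even k = subst₂ D (sym (U-at (2k≡2[k%r] k))) (sym (U-at (1+ (2k≡2[k%r] k))))
      (proj₁ (proj₂ (proj₂ u-cycle) (k %ℕ r)))

    U-in-odd : ∀ k → In U (1ℤ + + 2 * k)
    U-in-odd k = subst₂ D (sym (U-at (1+ (1+ (2k≡2[k%r] k))))) (sym (U-at (1+ (2k≡2[k%r] k))))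
      (proj₂ (proj₂ (proj₂ u-cycle) (k %ℕ r)))

    W-in-even : ∀ k → In W (+ 2 * k)
    W-in-even k = subst₂ D (sym (W-at (1+ (2k≡2[k%r] k)))) (sym (W-at (2k≡2[k%r] k)))
      (proj₁ (proj₂ (proj₂ w-cycle) (k %ℕ r)))

    W-out-odd : ∀ k → Out W (1ℤ + + 2 * k)
    W-out-odd k = subst₂ D (sym (W-at (1+ (2k≡2[k%r] k)))) (sym (W-at (1+ (1+ (2k≡2[k%r] k)))))
      (proj₂ (proj₂ (proj₂ w-cycle) (k %ℕ r)))

    private
      2≢0 : ¬ (+ 2 ≡ 0ℤ [mod + m ])
      2≢0 2≡0 with ≡-mod-small⇒≡ {m} {2} {0} (ℕ.s≤s (ℕ.s≤s (ℕ.≤-trans (ℕ.s≤s ℕ.z≤n) (ℕ.m≤n+m _ r′)))) (ℕ.s≤s ℕ.z≤n) 2≡0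
      ... | ()

      nonreturning-of : ∀ {S : ℤ → Fin n} → (∀ {x y} → S x ≡ S y → x ≡ y [mod + m ]) →
                        ∀ z → S z ≢ S (+ 2 + z)
      nonreturning-of injective z eq = 2≢0 (begin
        + 2               ≡⟨ 2≡[2+z]-z z ⟩
        (+ 2 + z) - z     ≈⟨ +-cong-mod (≡-mod-sym (injective eq)) ≡-mod-refl ⟩
        z - z             ≡⟨ ℤ.+-inverseʳ z ⟩
        0ℤ                ∎)
        where
        open ≡-mod-Reasoning (+ m)
        2≡[2+z]-z : ∀ z → + 2 ≡ (+ 2 + z) - z
        2≡[2+z]-z = solve-∀

      1+[1+2k]≡2+2k : ∀ k → 1ℤ + (1ℤ + + 2 * k) ≡ + 2 + + 2 * k
      1+[1+2k]≡2+2k = solve-∀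
      2[1+k]≡1+[1+2k] : ∀ k → + 2 * (1ℤ + k) ≡ 1ℤ + (1ℤ + + 2 * k)
      2[1+k]≡1+[1+2k] = solve-∀
      1+2[1+k]≡2+[1+2k] : ∀ k → 1ℤ + + 2 * (1ℤ + k) ≡ + 2 + (1ℤ + + 2 * k)
      1+2[1+k]≡2+[1+2k] = solve-∀

    U-walk : AlternatingWalk U
    U-walk = record { alternates = alternates-U ; nonreturning = nonreturning-of U-injective }
      where
      alternates-U : ∀ z → Alternates (U z) (U (1ℤ + z)) (U (+ 2 + z))
      alternates-U z with even-or-odd z
      ... | k , inj₁ refl = inj₁ (U-out-even k , subst (λ i → D (U i) (U (1ℤ + + 2 * k))) (1+[1+2k]≡2+2k k) (U-in-odd k))
      ... | k , inj₂ refl = inj₂ (U-in-odd k ,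
        subst₂ (λ i j → D (U i) (U j)) (2[1+k]≡1+[1+2k] k) (1+2[1+k]≡2+[1+2k] k) (U-out-even (1ℤ + k)))

    W-walk : AlternatingWalk W
    W-walk = record { alternates = alternates-W ; nonreturning = nonreturning-of W-injective }
      where
      alternates-W : ∀ z → Alternates (W z) (W (1ℤ + z)) (W (+ 2 + z))
      alternates-W z with even-or-odd z
      ... | k , inj₁ refl = inj₂ (W-in-even k , subst (λ i → D (W (1ℤ + + 2 * k)) (W i)) (1+[1+2k]≡2+2k k) (W-out-odd k))
      ... | k , inj₂ refl = inj₁ (W-out-odd k ,
        subst₂ (λ i j → D (W i) (W j)) (1+2[1+k]≡2+[1+2k] k) (2[1+k]≡1+[1+2k] k) (W-in-even (1ℤ + k)))

    v→U₁ : D v (U 1ℤ)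
    v→U₁ = subst (λ x → D x (U 1ℤ)) U₀≡v (U-out-even 0ℤ)

    v→U₋₁ : D v (U -1ℤ)
    v→U₋₁ = subst (λ x → D x (U -1ℤ)) U₀≡v (U-in-odd -1ℤ)

    W₁→v : D (W 1ℤ) v
    W₁→v = subst (D (W 1ℤ)) W₀≡v (W-in-even 0ℤ)

    W₋₁→v : D (W -1ℤ) v
    W₋₁→v = subst (D (W -1ℤ)) W₀≡v (W-out-odd -1ℤ)

    open DegreeTwo v→U₁ v→U₋₁ W₁→v W₋₁→v
      (λ eq → AlternatingWalk.nonreturning U-walk -1ℤ (sym eq))
      (λ eq → AlternatingWalk.nonreturning W-walk -1ℤ (sym eq))
    open Walks out-degree≤2 in-degree≤2

    meeting-reverses-direction : ∀ {z y} → U z ≡ W y → ¬ SameDirection U z W y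
    meeting-reverses-direction {z} {y} Uz≡Wy same =
      contradict (image-of-walk {g = λ x → x} {z = z} {y = y} has-id U-walk W-walk Uz≡Wy same)
      where
      Wσ→v : ∀ {σ} → IsSign σ → D (W σ) v
      Wσ→v (inj₁ refl) = W₁→v
      Wσ→v (inj₂ refl) = W₋₁→v

      contradict : ¬ (∃ λ σ → IsSign σ × ∀ j → U j ≡ W (y + σ * (j - z)))
      contradict (σ , σ-sign , U≡W) = arc-asym (subst (D v) U₁≡Wσ v→U₁) (Wσ→v σ-sign)
        where
        0↦0 : y + σ * (0ℤ - z) ≡ 0ℤ [mod + m ]
        0↦0 = W-injective (trans (sym (U≡W 0ℤ)) (trans U₀≡v (sym W₀≡v)))

        U₁≡Wσ : U 1ℤ ≡ W σ
        U₁≡Wσ = trans (U≡W 1ℤ) (W-cong (begin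
          y + σ * (1ℤ - z)          ≡⟨ regroup y σ z ⟩
          (y + σ * (0ℤ - z)) + σ    ≈⟨ +-cong-mod 0↦0 ≡-mod-refl ⟩
          0ℤ + σ                    ≡⟨ ℤ.+-identityˡ σ ⟩
          σ                         ∎))
          where
          open ≡-mod-Reasoning (+ m)
          regroup : ∀ y σ z → y + σ * (1ℤ - z) ≡ (y + σ * (0ℤ - z)) + σ
          regroup = solve-∀

    opposite-directions : ∀ {z y} → U z ≡ W y → (Out U z × In W y) ⊎ (In U z × Out W y)
    opposite-directions {z} {y} Uz≡Wy with out-or-in U-walk z | out-or-in W-walk y
    ... | inj₁ out-U | inj₁ out-W = contradiction (both-out out-U out-W) (meeting-reverses-direction {z} {y} Uz≡Wy)
    ... | inj₂ in-U  | inj₂ in-W  = contradiction (both-in in-U in-W) (meeting-reverses-direction {z} {y} Uz≡Wy)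
    ... | inj₁ out-U | inj₂ in-W  = inj₁ (out-U , in-W)
    ... | inj₂ in-U  | inj₁ out-W = inj₂ (in-U , out-W)

    direction-transfer : ∀ {z z' j j'} → SameDirection U z U z' → U z ≡ W j → U z' ≡ W j' →
                         SameDirection W j W j'
    direction-transfer {z} {z'} {j} {j'} same Uz≡Wj Uz'≡Wj'
      with opposite-directions {z} {j} Uz≡Wj | opposite-directions {z'} {j'} Uz'≡Wj'
    ... | inj₁ (_ , in-W) | inj₁ (_ , in-W') = both-in in-W in-W'
    ... | inj₂ (_ , out-W) | inj₂ (_ , out-W') = both-out out-W out-W'
    ... | inj₁ (out-U , _) | inj₂ (in-U' , _) with same
    ...   | both-out _ out-U' = contradiction in-U' (arc-asym out-U')
    ...   | both-in in-U _ = contradiction in-U (arc-asym out-U)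
    direction-transfer same _ _ | inj₂ (in-U , _) | inj₁ (out-U' , _) with same
    ...   | both-out out-U _ = contradiction in-U (arc-asym out-U)
    ...   | both-in _ in-U' = contradiction in-U' (arc-asym out-U')

    record Shared (z : ℤ) : Set where
      constructor shared
      field
        {partner} : ℤ
        meets     : U z ≡ W partner

    shared-0 : Shared 0ℤ
    shared-0 = shared {partner = 0ℤ} (trans U₀≡v (sym W₀≡v))

    shared-translate : ∀ {z z'} → Shared z → Shared z' → SameDirection U z U z' →
                       ∀ {y} → Shared y → Shared (y + (z' - z))
    shared-translate {z} {z'} (shared {j} Uz≡Wj) (shared {j'} Uz'≡Wj') same {y} (shared {t} Uy≡Wt) =
      translate (walk-translation {z = z} {y = z'} U-walk U-walk same)
      where
      translate : (∃ λ g → Mem g × ∀ i → g (U i) ≡ U (z' + (i - z))) → Shared (y + (z' - z))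
      translate (g , g∈G , gU≡U) = transport
        (image-of-walk {z = j} {y = j'} g∈G W-walk W-walk gWj≡Wj' (direction-transfer same Uz≡Wj Uz'≡Wj'))
        where
        gWj≡Wj' : g (W j) ≡ W j'
        gWj≡Wj' = trans (cong g (sym Uz≡Wj)) (trans (gU≡U z) (trans (cong U (z'+[z-z]≡z' z z')) Uz'≡Wj'))
          where
          z'+[z-z]≡z' : ∀ z z' → z' + (z - z) ≡ z'
          z'+[z-z]≡z' = solve-∀

        transport : (∃ λ σ → IsSign σ × ∀ i → g (W i) ≡ W (j' + σ * (i - j))) → Shared (y + (z' - z))
        transport (σ , _ , gW≡W) = shared (begin
          U (y + (z' - z))       ≡⟨ cong U (regroup y z z') ⟩
          U (z' + (y - z))       ≡⟨ gU≡U y ⟨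
          g (U y)                ≡⟨ cong g Uy≡Wt ⟩
          g (W t)                ≡⟨ gW≡W t ⟩
          W (j' + σ * (t - j))   ∎)
          where
          open ≡-Reasoning
          regroup : ∀ y z z' → y + (z' - z) ≡ z' + (y - z)
          regroup = solve-∀

    record Reflection : Set where
      field
        reflect   : Fin n → Fin n
        reflect-U : ∀ j → reflect (U j) ≡ U (- j)
        κ         : ℤ
        κ-sign    : IsSign κ
        reflect-W : ∀ j → reflect (W j) ≡ W (κ * j)

    opaque
      reflection : Reflection
      reflection = from-U (walk-translation₀ {y = 0ℤ} U-walk (reverse-walk U-walk)
                                             (both-out (U-out-even 0ℤ) (U-in-odd -1ℤ)))
        where
        from-U : (∃ λ h → Mem h × ∀ j → h (U j) ≡ U (- (0ℤ + j))) → Reflection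
        from-U (h , h∈G , hU≡U⁻) =
          from-W (image-of-walk₀ {y = 0ℤ} h∈G W-walk W-walk hW₀≡W₀ (both-in (W-in-even 0ℤ) (W-in-even 0ℤ)))
          where
          hW₀≡W₀ : h (W 0ℤ) ≡ W 0ℤ
          hW₀≡W₀ = trans (cong h (sym (Shared.meets shared-0))) (trans (hU≡U⁻ 0ℤ) (Shared.meets shared-0))

          from-W : (∃ λ κ → IsSign κ × ∀ j → h (W j) ≡ W (0ℤ + κ * j)) → Reflection
          from-W (κ , κ-sign , hW≡W) = record
            { reflect   = h
            ; reflect-U = λ j → trans (hU≡U⁻ j) (cong (U ∘ -_) (ℤ.+-identityˡ j))
            ; κ         = κ
            ; κ-sign    = κ-sign
            ; reflect-W = λ j → trans (hW≡W j) (cong W (ℤ.+-identityˡ (κ * j)))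
            }

    shared-neg : ∀ {z} → Shared z → Shared (- z)
    shared-neg {z} (shared {t} Uz≡Wt) = shared (begin
      U (- z)          ≡⟨ reflect-U z ⟨
      reflect (U z)    ≡⟨ cong reflect Uz≡Wt ⟩
      reflect (W t)    ≡⟨ reflect-W t ⟩
      W (κ * t)        ∎)
      where
      open ≡-Reasoning
      open Reflection reflection

    private
      a+[b-0]≡b+a : ∀ b a → b + (a - 0ℤ) ≡ a + b
      a+[b-0]≡b+a = solve-∀
      0+[a-[-b]]≡a+b : ∀ a b → 0ℤ + (a - - b) ≡ a + b
      0+[a-[-b]]≡a+b = solve-∀
      a+[0-[-b]]≡a+b : ∀ a b → a + (0ℤ - - b) ≡ a + b
      a+[0-[-b]]≡a+b = solve-∀

    shared-+ : ∀ {a b} → Shared a → Shared b → Shared (a + b)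
    shared-+ {a} {b} sa sb with out-or-in U-walk a | out-or-in U-walk (- b)
    ... | inj₁ out-a | _ =
      subst Shared (a+[b-0]≡b+a b a) (shared-translate shared-0 sa (both-out (U-out-even 0ℤ) out-a) sb)
    ... | inj₂ in-a | inj₂ in-b =
      subst Shared (0+[a-[-b]]≡a+b a b) (shared-translate (shared-neg sb) sa (both-in in-b in-a) shared-0)
    ... | inj₂ _ | inj₁ out-b =
      subst Shared (a+[0-[-b]]≡a+b a b) (shared-translate (shared-neg sb) shared-0 (both-out out-b (U-out-even 0ℤ)) sa)

    InW : ℕ → Set
    InW i = Any (λ j → u i ≡ w j) (upTo m)

    shared⇒inW : ∀ {i} → Shared (+ i) → InW i
    shared⇒inW {i} (shared {j} Ui≡Wj) = lose (∈-upTo⁺ (n%ℕd<d j m)) (begin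
      u i                ≡⟨ U-+ i ⟨
      U (+ i)            ≡⟨ Ui≡Wj ⟩
      W j                ≡⟨ W-at (≡-mod-%ℕ m j) ⟩
      w (j %ℕ m)         ∎)
      where open ≡-Reasoning

    inW⇒shared : ∀ {i} → InW i → Shared (+ i)
    inW⇒shared {i} inW with find inW
    ... | j , _ , ui≡wj = shared (trans (U-+ i) (trans ui≡wj (sym (W-+ j))))

    shared-m : Shared (+ m)
    shared-m = shared (trans (U-cong (≡0-mod-self (+ m))) (Shared.meets shared-0))

    open CyclicSubgroup {P = Shared} shared-0 shared-+ shared-neg
      (λ i → map′ inW⇒shared shared⇒inW (any? (λ j → u (suc i) ≟ᶠ w j) (upTo m)))
      using (generator)

    opaque
      δ-1 : ℕ
      δ-1 = proj₁ (generator shared-m)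

    δ : ℕ
    δ = suc δ-1

    opaque
      unfolding δ-1

      shared⇒δ∣ : ∀ {t} → Shared t → t ≡ 0ℤ [mod + δ ]
      shared⇒δ∣ = proj₁ (proj₂ (generator shared-m) _)

      δ∣⇒shared : ∀ {t} → t ≡ 0ℤ [mod + δ ] → Shared t
      δ∣⇒shared = proj₂ (proj₂ (generator shared-m) _)

    intersection-size : ∃ λ c → m ≡ c ℕ.* δ × interSize m u w ≡ c
    intersection-size = count (≡0-mod⇒∣ (shared⇒δ∣ shared-m))
      where
      count : δ ℕ.∣ m → ∃ λ c → m ≡ c ℕ.* δ × interSize m u w ≡ c
      count (ℕ.divides c m≡c*δ) = c , m≡c*δ , (begin
        length (filter (λ i → any? (λ j → u i ≟ᶠ w j) (upTo m)) (upTo m))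
          ≡⟨ cong length (filter-≐ (λ i → any? (λ j → u i ≟ᶠ w j) (upTo m)) (δ ℕ.∣?_)
               ((≡0-mod⇒∣ ∘ shared⇒δ∣ ∘ inW⇒shared) , (shared⇒inW ∘ δ∣⇒shared ∘ ∣⇒≡0-mod)) (upTo m)) ⟩
        length (filter (δ ℕ.∣?_) (upTo m))
          ≡⟨ cong (λ k → length (filter (δ ℕ.∣?_) (upTo k))) m≡c*δ ⟩
        length (filter (δ ℕ.∣?_) (upTo (c ℕ.* δ)))
          ≡⟨ count-multiples δ-1 c ⟩
        c ∎)
        where open ≡-Reasoning

    cofactor≡δ : ∀ {a ℓ} → a ≡ interSize m u w → a ℕ.* ℓ ≡ m → ℓ ≡ δ
    cofactor≡δ {a} {ℓ} a≡size a*ℓ≡m with intersection-size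
    ... | c , m≡c*δ , size≡c = cofactor-unique {a} a*ℓ≡m (begin
      a ℕ.* δ    ≡⟨ cong (ℕ._* δ) (trans a≡size size≡c) ⟩
      c ℕ.* δ    ≡⟨ m≡c*δ ⟨
      m          ∎)
      where open ≡-Reasoning

    module Jumps (a ℓ : ℕ) (a*ℓ≡m : a ℕ.* ℓ ≡ m) (ℓ≡δ : ℓ ≡ δ) (ℓ-odd : ∃ λ k → ℓ ≡ suc (2 ℕ.* k)) where

      L A : ℤ
      L = + ℓ
      A = + a

      private
        instance
          L-nonZero : ℤ.NonZero L
          L-nonZero = subst ℕ.NonZero (sym (proj₂ ℓ-odd)) _

        A*L≡m : A * L ≡ + m
        A*L≡m = trans (sym (ℤ.pos-* a ℓ)) (cong +_ a*ℓ≡m)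

        scale : ∀ {x y} → x ≡ y [mod A ] → x * L ≡ y * L [mod + m ]
        scale {x} {y} x≡y = subst (λ M → x * L ≡ y * L [mod M ]) A*L≡m (*-cong-mod-scale L x≡y)

        unscale : ∀ {x y} → x * L ≡ y * L [mod + m ] → x ≡ y [mod A ]
        unscale {x} {y} p = ≡-mod-*-cancelʳ L (subst (λ M → x * L ≡ y * L [mod M ]) (sym A*L≡m) p)

        shared⇒ℓ∣ : ∀ {t} → Shared t → t ≡ 0ℤ [mod L ]
        shared⇒ℓ∣ {t} = subst (λ d → t ≡ 0ℤ [mod + d ]) (sym ℓ≡δ) ∘ shared⇒δ∣

        ℓ∣⇒shared : ∀ {t} → t ≡ 0ℤ [mod L ] → Shared t
        ℓ∣⇒shared {t} = δ∣⇒shared ∘ subst (λ d → t ≡ 0ℤ [mod + d ]) ℓ≡δ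

      record Meet (i x : ℤ) : Set where
        constructor meet
        field U≡W : U (i * L) ≡ W (x * L)

      meet-cong : ∀ {i i' x x'} → i ≡ i' → x ≡ x' → Meet i x → Meet i' x'
      meet-cong refl refl m = m

      meet-unique : ∀ {i x y} → Meet i x → Meet i y → x ≡ y [mod A ]
      meet-unique (meet e) (meet f) = unscale (W-injective (trans (sym e) f))

      meet-injective : ∀ {i j x} → Meet i x → Meet j x → i ≡ j [mod A ]
      meet-injective (meet e) (meet f) = unscale (U-injective (trans e (sym f)))

      meet-resp : ∀ {i x y} → Meet i x → x ≡ y [mod A ] → Meet i y
      meet-resp (meet e) x≡y = meet (trans e (W-cong (scale x≡y)))

      meet-0 : Meet 0ℤ 0ℤ
      meet-0 = meet (Shared.meets shared-0)

      private
        L-in : In U L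
        L-in = subst (λ i → In U (+ i)) (sym (proj₂ ℓ-odd))
          (subst (λ i → In U (1ℤ + i)) (sym (ℤ.pos-* 2 (proj₁ ℓ-odd))) (U-in-odd (+ proj₁ ℓ-odd)))

        τ : Fin n → Fin n
        τ = proj₁ (vertex-transitive v (U L))

        τ∈G : Mem τ
        τ∈G = proj₁ (proj₂ (vertex-transitive v (U L)))

        τv≡UL : τ v ≡ U L
        τv≡UL = proj₂ (proj₂ (vertex-transitive v (U L)))

      opaque
        j₀ : ℤ
        j₀ = Shared.partner (ℓ∣⇒shared (≡0-mod-self L))

        UL≡Wj₀ : U L ≡ W j₀
        UL≡Wj₀ = Shared.meets (ℓ∣⇒shared (≡0-mod-self L))

      private
        j₀-out : Out W j₀
        j₀-out with opposite-directions {L} {j₀} UL≡Wj₀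
        ... | inj₁ (out-U , _) = contradiction L-in (arc-asym out-U)
        ... | inj₂ (_ , out-W) = out-W

        τ-on-U : ∃ λ σ → IsSign σ × ∀ i → τ (U i) ≡ W (j₀ + σ * i)
        τ-on-U = image-of-walk₀ {y = j₀} τ∈G U-walk W-walk
          (trans (cong τ U₀≡v) (trans τv≡UL UL≡Wj₀)) (both-out (U-out-even 0ℤ) j₀-out)

        τ-on-W : ∃ λ σ → IsSign σ × ∀ i → τ (W i) ≡ U (L + σ * i)
        τ-on-W = image-of-walk₀ {y = L} τ∈G W-walk U-walk (trans (cong τ W₀≡v) τv≡UL) (both-in (W-in-even 0ℤ) L-in)

      opaque
        σ₁ σ₂ : ℤ
        σ₁ = proj₁ τ-on-U
        σ₂ = proj₁ τ-on-W

        σ₁-sign : IsSign σ₁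
        σ₁-sign = proj₁ (proj₂ τ-on-U)

        σ₂-sign : IsSign σ₂
        σ₂-sign = proj₁ (proj₂ τ-on-W)

        τU≡W : ∀ i → τ (U i) ≡ W (j₀ + σ₁ * i)
        τU≡W = proj₂ (proj₂ τ-on-U)

        τW≡U : ∀ i → τ (W i) ≡ U (L + σ₂ * i)
        τW≡U = proj₂ (proj₂ τ-on-W)

      W-meets-U⇒ℓ∣ : ∀ {y t} → W y ≡ U t → y ≡ 0ℤ [mod L ]
      W-meets-U⇒ℓ∣ {y} {t} Wy≡Ut = begin
        y                            ≡⟨ sign-cancel σ₂-sign y ⟨
        σ₂ * (σ₂ * y)                ≡⟨ cong (σ₂ *_) (L+x-L≡x L (σ₂ * y)) ⟨
        σ₂ * ((L + σ₂ * y) - L)      ≈⟨ *-congˡ-mod σ₂ (+-cong-mod (shared⇒ℓ∣ image-shared) (-‿cong-mod (≡0-mod-self L))) ⟩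
        σ₂ * (0ℤ - 0ℤ)               ≡⟨ ℤ.*-zeroʳ σ₂ ⟩
        0ℤ                           ∎
        where
        open ≡-mod-Reasoning L
        L+x-L≡x : ∀ L x → (L + x) - L ≡ x
        L+x-L≡x = solve-∀
        image-shared : Shared (L + σ₂ * y)
        image-shared = shared (trans (sym (τW≡U y)) (trans (cong τ Wy≡Ut) (τU≡W t)))

      meet-exists : ∀ i → ∃ (Meet i)
      meet-exists i = from-shared (ℓ∣⇒shared (*≡0-mod i L))
        where
        from-shared : Shared (i * L) → ∃ (Meet i)
        from-shared (shared {j} Ui≡Wj) = to-meet (W-meets-U⇒ℓ∣ (sym Ui≡Wj))
          where
          to-meet : j ≡ 0ℤ [mod L ] → ∃ (Meet i)
          to-meet (mod-intro (divides x j-0≡x*L)) =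
            x , meet (trans Ui≡Wj (cong W (trans (sym (ℤ.+-identityʳ j)) j-0≡x*L)))

      opaque
        p : ℤ
        p = proj₁ (meet-exists 1ℤ)

        meet-1 : Meet 1ℤ p
        meet-1 = proj₂ (meet-exists 1ℤ)

      τ-meet : ∀ {i x} → Meet i x → Meet (1ℤ + σ₂ * x) (p + σ₁ * i)
      τ-meet {i} {x} (meet e) = meet (begin
        U ((1ℤ + σ₂ * x) * L)        ≡⟨ cong U ([1+σx]L≡L+σ[xL] σ₂ x L) ⟩
        U (L + σ₂ * (x * L))         ≡⟨ τW≡U (x * L) ⟨
        τ (W (x * L))                ≡⟨ cong τ e ⟨
        τ (U (i * L))                ≡⟨ τU≡W (i * L) ⟩
        W (j₀ + σ₁ * (i * L))        ≡⟨ W-cong (+-cong-mod j₀≡pL ≡-mod-refl) ⟩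
        W (p * L + σ₁ * (i * L))     ≡⟨ cong W (pL+σ[iL]≡[p+σi]L p σ₁ i L) ⟩
        W ((p + σ₁ * i) * L)         ∎)
        where
        open ≡-Reasoning
        [1+σx]L≡L+σ[xL] : ∀ σ x L → (1ℤ + σ * x) * L ≡ L + σ * (x * L)
        [1+σx]L≡L+σ[xL] = solve-∀
        pL+σ[iL]≡[p+σi]L : ∀ p σ i L → p * L + σ * (i * L) ≡ (p + σ * i) * L
        pL+σ[iL]≡[p+σi]L = solve-∀
        j₀≡pL : j₀ ≡ p * L [mod + m ]
        j₀≡pL = W-injective (trans (sym UL≡Wj₀)
                  (trans (cong U (sym (ℤ.*-identityˡ L))) (Meet.U≡W meet-1)))

      open Reflection reflection using (reflect; reflect-U; κ; κ-sign; reflect-W)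

      reflection-meet : ∀ {i x} → Meet i x → Meet (- i) (κ * x)
      reflection-meet {i} {x} (meet e) = meet (begin
        U (- i * L)             ≡⟨ cong U (ℤ.neg-distribˡ-* i L) ⟨
        U (- (i * L))           ≡⟨ reflect-U (i * L) ⟨
        reflect (U (i * L))     ≡⟨ cong reflect e ⟩
        reflect (W (x * L))     ≡⟨ reflect-W (x * L) ⟩
        W (κ * (x * L))         ≡⟨ cong W (ℤ.*-assoc κ x L) ⟨
        W (κ * x * L)           ∎)
        where open ≡-Reasoning

      meet-neg : ∀ {i x} → Meet i x → Meet (- i) (- x)
      meet-neg = from-sign κ-sign reflection-meet
        where
        from-sign : ∀ {σ} → IsSign σ → (∀ {i x} → Meet i x → Meet (- i) (σ * x)) →
                    ∀ {i x} → Meet i x → Meet (- i) (- x)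
        from-sign (inj₂ refl) mirror {x = x} m = meet-cong refl (ℤ.-1*i≡-i x) (mirror m)
        -- σ = κ = 1 forces a ∣ 2, and then every residue equals its negative.
        from-sign (inj₁ refl) mirror {x = x} m = meet-resp (mirror m)
          (≡-mod-trans (≡-mod-reflexive (ℤ.*-identityˡ x)) (≡-mod-sym (2≡0⇒-x≡x 2≡0 x)))
          where
          2≡0 : + 2 ≡ 0ℤ [mod A ]
          2≡0 = +-cong-mod (meet-injective meet-1 (meet-cong refl (ℤ.*-identityˡ p) (mirror meet-1)))
                           (≡-mod-refl {x = 1ℤ})

      opaque
        c : ℤ
        c = proj₁ (meet-exists (+ 2))

        meet-2 : Meet (+ 2) c
        meet-2 = proj₂ (meet-exists (+ 2))

      rotation-meet : ∃ λ η → IsSign η × ∀ {i x} → Meet i x → Meet (+ 2 + i) (c + η * x)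
      rotation-meet = from-rotation (walk-translation₀ {y = + 2 * L} U-walk U-walk
                                      (both-out (U-out-even 0ℤ) (U-out-even L)))
        where
        2L-in : In W (c * L)
        2L-in with opposite-directions {+ 2 * L} {c * L} (Meet.U≡W meet-2)
        ... | inj₁ (_ , in-W) = in-W
        ... | inj₂ (in-U , _) = contradiction in-U (arc-asym (U-out-even L))

        from-rotation : (∃ λ ρ → Mem ρ × ∀ j → ρ (U j) ≡ U (+ 2 * L + j)) →
                        ∃ λ η → IsSign η × ∀ {i x} → Meet i x → Meet (+ 2 + i) (c + η * x)
        from-rotation (ρ , ρ∈G , ρU≡U) = on-W (image-of-walk₀ {y = c * L} ρ∈G W-walk W-walk ρW₀≡WcL
                                                 (both-in (W-in-even 0ℤ) 2L-in))
          where
          ρW₀≡WcL : ρ (W 0ℤ) ≡ W (c * L)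
          ρW₀≡WcL = trans (cong ρ (sym (Shared.meets shared-0)))
                      (trans (ρU≡U 0ℤ) (trans (cong U (ℤ.+-identityʳ (+ 2 * L))) (Meet.U≡W meet-2)))

          on-W : (∃ λ η → IsSign η × ∀ j → ρ (W j) ≡ W (c * L + η * j)) →
                 ∃ λ η → IsSign η × ∀ {i x} → Meet i x → Meet (+ 2 + i) (c + η * x)
          on-W (η , η-sign , ρW≡W) = η , η-sign , λ {i} {x} (meet e) → meet (begin
            U ((+ 2 + i) * L)          ≡⟨ cong U (ℤ.*-distribʳ-+ L (+ 2) i) ⟩
            U (+ 2 * L + i * L)        ≡⟨ ρU≡U (i * L) ⟨
            ρ (U (i * L))              ≡⟨ cong ρ e ⟩
            ρ (W (x * L))              ≡⟨ ρW≡W (x * L) ⟩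
            W (c * L + η * (x * L))    ≡⟨ cong W (regroup c η x L) ⟩
            W ((c + η * x) * L)        ∎)
            where
            open ≡-Reasoning
            regroup : ∀ c η x L → c * L + η * (x * L) ≡ (c + η * x) * L
            regroup = solve-∀

      meet-step : ∀ {i x} → Meet i x → Meet (+ 2 + i) (+ 2 * p + x)
      meet-step = by-sign rotation-meet
        where
        by-sign : (∃ λ η → IsSign η × ∀ {i x} → Meet i x → Meet (+ 2 + i) (c + η * x)) →
                  ∀ {i x} → Meet i x → Meet (+ 2 + i) (+ 2 * p + x)
        by-sign (_ , inj₁ refl , rotate) {x = x} m = meet-resp (rotate m) (begin
          c + 1ℤ * x                 ≡⟨ regroup c p x ⟩
          (c + 1ℤ * - p) + (p + x)   ≈⟨ +-cong-mod (meet-unique (rotate (meet-neg meet-1)) meet-1) ≡-mod-refl ⟩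
          p + (p + x)                ≡⟨ p+[p+x]≡2p+x p x ⟩
          + 2 * p + x                ∎)
          where
          open ≡-mod-Reasoning A
          regroup : ∀ c p x → c + 1ℤ * x ≡ (c + 1ℤ * - p) + (p + x)
          regroup = solve-∀
          p+[p+x]≡2p+x : ∀ p x → p + (p + x) ≡ + 2 * p + x
          p+[p+x]≡2p+x = solve-∀
        -- η = -1 forces c ≡ 0 and then a ∣ 2.
        by-sign (_ , inj₂ refl , rotate) {x = x} m = meet-resp (rotate m) (begin
          c + -1ℤ * x        ≈⟨ +-cong-mod c≡0 (≡-mod-reflexive (ℤ.-1*i≡-i x)) ⟩
          0ℤ + - x           ≈⟨ +-cong-mod (≡-mod-sym 2p≡0) (2≡0⇒-x≡x 2≡0 x) ⟩
          + 2 * p + x        ∎)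
          where
          open ≡-mod-Reasoning A
          c≡0 : c ≡ 0ℤ [mod A ]
          c≡0 = begin
            c                            ≡⟨ c≡[c+-1*-p]+-p c p ⟩
            (c + -1ℤ * - p) + - p        ≈⟨ +-cong-mod (meet-unique (rotate (meet-neg meet-1)) meet-1) ≡-mod-refl ⟩
            p + - p                      ≡⟨ ℤ.+-inverseʳ p ⟩
            0ℤ                           ∎
            where
            c≡[c+-1*-p]+-p : ∀ c p → c ≡ (c + -1ℤ * - p) + - p
            c≡[c+-1*-p]+-p = solve-∀
          2≡0 : + 2 ≡ 0ℤ [mod A ]
          2≡0 = meet-injective (meet-resp (rotate meet-0) (≡-mod-trans (≡-mod-reflexive (ℤ.+-identityʳ c)) c≡0)) meet-0
          2p≡0 : + 2 * p ≡ 0ℤ [mod A ]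
          2p≡0 = subst₂ (λ a b → a ≡ b [mod A ]) (ℤ.*-comm p (+ 2)) (ℤ.*-zeroʳ p) (*-congˡ-mod p 2≡0)

      meet-linear-ℕ : ∀ k → Meet (+ k) (p * + k)
      meet-linear-ℕ zero = meet-cong refl (sym (ℤ.*-zeroʳ p)) meet-0
      meet-linear-ℕ (suc zero) = meet-cong refl (sym (ℤ.*-identityʳ p)) meet-1
      meet-linear-ℕ (suc (suc k)) = meet-cong refl (2p+pk≡p[2+k] p (+ k)) (meet-step (meet-linear-ℕ k))
        where
        2p+pk≡p[2+k] : ∀ p k → + 2 * p + p * k ≡ p * (+ 2 + k)
        2p+pk≡p[2+k] = solve-∀

      meet-linear : ∀ z → Meet z (p * z)
      meet-linear (+ k) = meet-linear-ℕ k
      meet-linear -[1+ k ] = meet-cong refl (ℤ.neg-distribʳ-* p (+ suc k)) (meet-neg (meet-linear-ℕ (suc k)))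

      ξ : ℤ
      ξ = σ₂ * σ₁

      ξ-sign : IsSign ξ
      ξ-sign = sign-* σ₂-sign σ₁-sign

      p²≡ξ : p * p ≡ ξ [mod A ]
      p²≡ξ = begin
        p * p                           ≡⟨ sign-cancel σ₂-sign (p * p) ⟨
        σ₂ * (σ₂ * (p * p))             ≡⟨ cong (σ₂ *_) (regroup p σ₂) ⟩
        σ₂ * (p * (1ℤ + σ₂ * p) - p)    ≈⟨ *-congˡ-mod σ₂ (+-cong-mod (meet-unique (meet-linear _) (τ-meet meet-1))
                                                                     ≡-mod-refl) ⟩
        σ₂ * ((p + σ₁ * 1ℤ) - p)        ≡⟨ cong (σ₂ *_) (p+σ*1-p≡σ p σ₁) ⟩
        ξ                               ∎
        where
        open ≡-mod-Reasoning A
        regroup : ∀ p σ → σ * (p * p) ≡ p * (1ℤ + σ * p) - p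
        regroup = solve-∀
        p+σ*1-p≡σ : ∀ p σ → (p + σ * 1ℤ) - p ≡ σ
        p+σ*1-p≡σ = solve-∀

      Jump : ℕ → Set
      Jump q = ∃ λ θ → IsSign θ × + q ≡ θ * p [mod A ]

      jump² : ∀ {q} → Jump q → + q * + q ≡ ξ [mod A ]
      jump² {q} (θ , θ-sign , q≡θp) = begin
        + q * + q               ≈⟨ *-cong-mod q≡θp q≡θp ⟩
        (θ * p) * (θ * p)       ≡⟨ regroup θ p ⟩
        θ * (θ * (p * p))       ≡⟨ sign-cancel θ-sign (p * p) ⟩
        p * p                   ≈⟨ p²≡ξ ⟩
        ξ                       ∎
        where
        open ≡-mod-Reasoning A
        regroup : ∀ θ p → (θ * p) * (θ * p) ≡ θ * (θ * (p * p))
        regroup = solve-∀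

      meet-sign⇒jump : ∀ {q θ} → IsSign θ → Meet (+ q) θ → Jump q
      meet-sign⇒jump {q} {θ} θ-sign m = ξ * θ , sign-* ξ-sign θ-sign , (begin
        + q                     ≡⟨ sign-cancel ξ-sign (+ q) ⟨
        ξ * (ξ * + q)           ≈⟨ *-congˡ-mod ξ (*-cong-mod (≡-mod-sym p²≡ξ) ≡-mod-refl) ⟩
        ξ * ((p * p) * + q)     ≡⟨ cong (ξ *_) (ℤ.*-assoc p p (+ q)) ⟩
        ξ * (p * (p * + q))     ≈⟨ *-congˡ-mod ξ (*-congˡ-mod p (meet-unique (meet-linear (+ q)) m)) ⟩
        ξ * (p * θ)             ≡⟨ regroup ξ p θ ⟩
        ξ * θ * p               ∎)
        where
        open ≡-mod-Reasoning A
        regroup : ∀ ξ p θ → ξ * (p * θ) ≡ ξ * θ * p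
        regroup = solve-∀

      jump⇒meet-sign : ∀ {q} → Jump q → ∃ λ θ → IsSign θ × Meet (+ q) θ
      jump⇒meet-sign {q} (θ , θ-sign , q≡θp) = θ * ξ , sign-* θ-sign ξ-sign , meet-resp (meet-linear (+ q)) (begin
        p * + q                 ≈⟨ *-congˡ-mod p q≡θp ⟩
        p * (θ * p)             ≡⟨ regroup p θ ⟩
        θ * (p * p)             ≈⟨ *-congˡ-mod θ p²≡ξ ⟩
        θ * ξ                   ∎)
        where
        open ≡-mod-Reasoning A
        regroup : ∀ p θ → p * (θ * p) ≡ θ * (p * p)
        regroup = solve-∀

      TailJump HeadJump : ℕ → Set
      TailJump q = w (q ℕ.* ℓ) ≡ u ℓ ⊎ w (q ℕ.* ℓ) ≡ u (m ℕ.∸ ℓ)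
      HeadJump q = u (q ℕ.* ℓ) ≡ w ℓ ⊎ u (q ℕ.* ℓ) ≡ w (m ℕ.∸ ℓ)

      private
        ℓ≤m : ℓ ℕ.≤ m
        ℓ≤m = bound a a*ℓ≡m
          where
          bound : ∀ b → b ℕ.* ℓ ≡ m → ℓ ℕ.≤ m
          bound (suc b) b*ℓ≡m = subst (ℓ ℕ.≤_) b*ℓ≡m (ℕ.m≤m+n ℓ (b ℕ.* ℓ))

        m-ℓ≡-L : + (m ℕ.∸ ℓ) ≡ -1ℤ * L [mod + m ]
        m-ℓ≡-L = begin
          + (m ℕ.∸ ℓ)     ≡⟨ trans (ℤ.[+m]-[+n]≡m⊖n m ℓ) (ℤ.⊖-≥ ℓ≤m) ⟨
          + m - L         ≈⟨ +-cong-mod (≡0-mod-self (+ m)) (≡-mod-refl {x = - L}) ⟩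
          0ℤ - L          ≡⟨ trans (ℤ.+-identityˡ (- L)) (sym (ℤ.-1*i≡-i L)) ⟩
          -1ℤ * L         ∎
          where open ≡-mod-Reasoning (+ m)

        u-at : ∀ {i j} → + i ≡ j [mod + m ] → u i ≡ U j
        u-at {i} i≡j = trans (sym (U-+ i)) (U-cong i≡j)

        w-at : ∀ {i j} → + i ≡ j [mod + m ] → w i ≡ W j
        w-at {i} i≡j = trans (sym (W-+ i)) (W-cong i≡j)

        q*ℓ : ∀ q → + (q ℕ.* ℓ) ≡ + q * L [mod + m ]
        q*ℓ q = ≡-mod-reflexive (ℤ.pos-* q ℓ)

        1*ℓ : + ℓ ≡ 1ℤ * L [mod + m ]
        1*ℓ = ≡-mod-reflexive (sym (ℤ.*-identityˡ L))

      tail⇒jump : ∀ {q} → TailJump q → Jump q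
      tail⇒jump {q} (inj₁ e) = 1ℤ , inj₁ refl , ≡-mod-trans (≡-mod-sym (meet-unique meet-1 q-meet))
                                                             (≡-mod-reflexive (sym (ℤ.*-identityˡ p)))
        where
        q-meet : Meet 1ℤ (+ q)
        q-meet = meet (sym (trans (sym (w-at (q*ℓ q))) (trans e (u-at 1*ℓ))))
      tail⇒jump {q} (inj₂ e) = -1ℤ , inj₂ refl , ≡-mod-trans (≡-mod-sym (meet-unique (meet-neg meet-1) q-meet))
                                                               (≡-mod-reflexive (sym (ℤ.-1*i≡-i p)))
        where
        q-meet : Meet -1ℤ (+ q)
        q-meet = meet (sym (trans (sym (w-at (q*ℓ q))) (trans e (u-at m-ℓ≡-L))))

      jump⇒tail : ∀ {q} → Jump q → TailJump q
      jump⇒tail {q} (.1ℤ , inj₁ refl , q≡p) = inj₁ (trans (w-at (q*ℓ q)) (trans (sym (Meet.U≡W q-meet)) (sym (u-at 1*ℓ))))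
        where
        q-meet : Meet 1ℤ (+ q)
        q-meet = meet-resp meet-1 (≡-mod-sym (≡-mod-trans q≡p (≡-mod-reflexive (ℤ.*-identityˡ p))))
      jump⇒tail {q} (.-1ℤ , inj₂ refl , q≡-p) = inj₂ (trans (w-at (q*ℓ q)) (trans (sym (Meet.U≡W q-meet)) (sym (u-at m-ℓ≡-L))))
        where
        q-meet : Meet -1ℤ (+ q)
        q-meet = meet-resp (meet-neg meet-1) (≡-mod-sym (≡-mod-trans q≡-p (≡-mod-reflexive (ℤ.-1*i≡-i p))))

      head⇒jump : ∀ {q} → HeadJump q → Jump q
      head⇒jump {q} (inj₁ e) = meet-sign⇒jump (inj₁ refl) (meet (trans (sym (u-at (q*ℓ q))) (trans e (w-at 1*ℓ))))
      head⇒jump {q} (inj₂ e) = meet-sign⇒jump (inj₂ refl) (meet (trans (sym (u-at (q*ℓ q))) (trans e (w-at m-ℓ≡-L))))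

      jump⇒head : ∀ {q} → Jump q → HeadJump q
      jump⇒head {q} j = from-meet (jump⇒meet-sign j)
        where
        from-meet : (∃ λ θ → IsSign θ × Meet (+ q) θ) → HeadJump q
        from-meet (.1ℤ , inj₁ refl , meet e) = inj₁ (trans (u-at (q*ℓ q)) (trans e (sym (w-at 1*ℓ))))
        from-meet (.-1ℤ , inj₂ refl , meet e) = inj₂ (trans (u-at (q*ℓ q)) (trans e (sym (w-at m-ℓ≡-L))))

      jump-theorem : ∀ {qt qh} → IsLeast TailJump qt → IsLeast HeadJump qh → SqPM1 (qt ℕ.⊓ qh) a × qt ≡ qh
      jump-theorem {qt} {qh} (tail-qt , qt-least) (head-qh , qh-least) =
        subst (λ q → SqPM1 q a) (sym qt⊓qh≡qt) (sq≡±1⇒SqPM1 {qt} ξ-sign (jump² (tail⇒jump {qt} tail-qt))) , qt≡qh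
        where
        qt≡qh : qt ≡ qh
        qt≡qh = ℕ.≤-antisym (qt-least qh (jump⇒tail (head⇒jump {qh} head-qh)))
                            (qh-least qt (jump⇒head (tail⇒jump {qt} tail-qt)))
        qt⊓qh≡qt : qt ℕ.⊓ qh ≡ qt
        qt⊓qh≡qt = trans (cong (qt ℕ.⊓_) (sym qt≡qh)) (ℕ.⊓-idem qt)

open import Data.Nat using (ℕ; _+_; _*_; _∸_; _⊓_; zero; suc; s≤s)
open import Data.Nat.Divisibility using (_∣_)
open import Data.Product using (_×_; _,_)
open import Data.Sum using (_⊎_)
open import Relation.Nullary using (¬_)
open import Relation.Binary.PropositionalEquality using (_≡_)
open Preliminaries using (odd-cofactor)

lemma6p1 : (n : ℕ) (Γ : Graph n) (G : Subgroup Γ) →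
    Connected Γ → Tetravalent Γ → HalfArcTransitive Γ G →
    (D : Fin n → Fin n → Set) → IsOrientation Γ G D →
    (v : Fin n) (r : ℕ) (u w : ℕ → Fin n) →
    AltCycleTail Γ D v r u → AltCycleHead Γ D v r w →
    (a ℓ : ℕ) → a ≡ interSize (2 * r) u w → a * ℓ ≡ 2 * r →
    (qt qh : ℕ) →
    IsLeast (λ q → w (q * ℓ) ≡ u ℓ ⊎ w (q * ℓ) ≡ u (2 * r ∸ ℓ)) qt →
    IsLeast (λ q → u (q * ℓ) ≡ w ℓ ⊎ u (q * ℓ) ≡ w (2 * r ∸ ℓ)) qh →
    ¬ (a ∣ r) → ¬ (a ≡ n) →
    SqPM1 (qt ⊓ qh) a × qt ≡ qh
lemma6p1 _ _ _ _ _ _ _ _ _ zero _ _ ((() , _) , _) _ _ _ _ _ _ _ _ _ _ _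
lemma6p1 _ _ _ _ _ _ _ _ _ (suc zero) _ _ ((s≤s () , _) , _) _ _ _ _ _ _ _ _ _ _ _
lemma6p1 n Γ G _ tetravalent (vertex-transitive , _) D orientation v (suc (suc r′)) u w u-cycle w-cycle
         a ℓ a≡size a*ℓ≡m qt qh qt-least qh-least a∤r _ =
  Jumps.jump-theorem a ℓ a*ℓ≡m (cofactor≡δ a≡size a*ℓ≡m) (odd-cofactor a*ℓ≡m a∤r) qt-least qh-least
  where
  open OrientedGraph Γ G tetravalent vertex-transitive orientation
  open AlternatingCycles v r′ u w u-cycle w-cycle
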